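{- Let $\Gamma$ be a finite connected graph on $k\geq 1$ vertices, let $n\geq 1$ be an integer, and let $\Gamma_n$ be the join of $\Gamma$ with the complete graph $K_n$. Then $\operatorname{Pic}^0(\Gamma_n)$ has a subgroup isomorphic to $(\mathbb{Z}/(n+k)\mathbb{Z})^{n-1}$, and \[ |\operatorname{Pic}^0(\Gamma_n)| = (n+k)^{n-1}\,|P_{\Gamma}(-n)|, \] where $P_{\Gamma}(x)$ is the characteristic polynomial of the rational Laplacian operator of $\Gamma$.
   Context: All graphs are finite, non-empty and connected. The join of two graphs $\Gamma_1,\Gamma_2$ is obtained from their disjoint union by joining every vertex of $\Gamma_1$ to every vertex of $\Gamma_2$ by an edge. For a graph $\Gamma$, $\operatorname{Div}(\Gamma)$ is the free abelian group on $V(\Gamma)$, and $\operatorname{Div}^0(\Gamma)$ is the kernel of the degree map $\sum a_v v\mapsto \sum a_v$. The Laplacian operator $\Delta(\Gamma):\operatorname{Div}(\Gamma)\to\operatorname{Div}^0(\Gamma)$ is given by $v\mapsto (\deg v)\,v-\sum_{wv\in E(\Gamma)} w$, and $\operatorname{Pic}^0(\Gamma)=\operatorname{Div}^0(\Gamma)/\operatorname{im}\Delta(\Gamma)$. The rational Laplacian operator is the endomorphism of $\operatorname{Div}^0(\Gamma)\otimes_{\mathbb{Z}}\mathbb{Q}$ induced by $\Delta(\Gamma)$, and $P_\Gamma(x)$ is its characteristic polynomial, with the convention $P_\Gamma(x)=1$ if $\Gamma$ has one vertex. -}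

module Defs where

open import Data.Nat using (ℕ; zero; suc; _+_; _∸_; _^_; _≤_)
open import Data.Integer as ℤ using (ℤ; 0ℤ; 1ℤ; +_; -_; ∣_∣)
open import Data.Integer.Divisibility using (_∣_)
open import Data.Fin using (Fin; zero; suc; splitAt; inject₁; fromℕ; punchIn; _≟_)
open import Data.Bool using (Bool; true; false; not; if_then_else_)
open import Data.Sum using (_⊎_; inj₁; inj₂)
open import Data.Product using (Σ; _×_; ∃; _,_)
open import Relation.Nullary using (yes; no; does)
open import Relation.Binary.PropositionalEquality using (_≡_; refl; sym)

record Graph (k : ℕ) : Set where
  field
    adj    : Fin k → Fin k → Bool
    adj-sym : ∀ u v → adj u v ≡ adj v u
    adj-irrefl : ∀ v → adj v v ≡ false
open Graph public

data Reach {k : ℕ} (Γ : Graph k) : Fin k → Fin k → Set where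
  here : ∀ {v} → Reach Γ v v
  step : ∀ {u w v} → adj Γ u w ≡ true → Reach Γ w v → Reach Γ u v

Connected : ∀ {k} → Graph k → Set
Connected Γ = ∀ u v → Reach Γ u v

-- Join of Γ (vertices Fin k) with the complete graph K_n (vertices Fin n);
-- vertex set Fin (k + n), the first k vertices being those of Γ.

private
  neqB : ∀ {n} → Fin n → Fin n → Bool
  neqB a b = not (does (a ≟ b))

  neqB-sym : ∀ {n} (a b : Fin n) → neqB a b ≡ neqB b a
  neqB-sym a b with a ≟ b | b ≟ a
  ... | yes _ | yes _ = refl
  ... | no _  | no _  = refl
  ... | yes p | no q  with q (sym p)
  ... | ()
  neqB-sym a b | no q | yes p with q (sym p)
  ... | ()

  neqB-irr : ∀ {n} (a : Fin n) → neqB a a ≡ false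
  neqB-irr a with a ≟ a
  ... | yes _ = refl
  ... | no q with q refl
  ... | ()

joinAdj : ∀ {k} → Graph k → (n : ℕ) → Fin (k + n) → Fin (k + n) → Bool
joinAdj {k} Γ n u v with splitAt k u | splitAt k v
... | inj₁ a | inj₁ b = adj Γ a b
... | inj₂ a | inj₂ b = neqB a b
... | inj₁ _ | inj₂ _ = true
... | inj₂ _ | inj₁ _ = true

private
  joinAdj-sym : ∀ {k} (Γ : Graph k) n u v → joinAdj Γ n u v ≡ joinAdj Γ n v u
  joinAdj-sym {k} Γ n u v with splitAt k u | splitAt k v
  ... | inj₁ a | inj₁ b = adj-sym Γ a b
  ... | inj₂ a | inj₂ b = neqB-sym a b
  ... | inj₁ _ | inj₂ _ = refl
  ... | inj₂ _ | inj₁ _ = refl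

  joinAdj-irr : ∀ {k} (Γ : Graph k) n u → joinAdj Γ n u u ≡ false
  joinAdj-irr {k} Γ n u with splitAt k u
  ... | inj₁ a = adj-irrefl Γ a
  ... | inj₂ a = neqB-irr a

join : ∀ {k} → Graph k → (n : ℕ) → Graph (k + n)
join Γ n = record
  { adj = joinAdj Γ n
  ; adj-sym = joinAdj-sym Γ n
  ; adj-irrefl = joinAdj-irr Γ n }

sumFin : ∀ {N} → (Fin N → ℤ) → ℤ
sumFin {zero}  f = 0ℤ
sumFin {suc N} f = f zero ℤ.+ sumFin (λ i → f (suc i))

Div : ℕ → Set
Div N = Fin N → ℤ

deg : ∀ {N} → Div N → ℤ
deg = sumFin

_⊕_ : ∀ {N} → Div N → Div N → Div N
(D ⊕ E) v = D v ℤ.+ E v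

ind : Bool → ℤ
ind b = if b then 1ℤ else 0ℤ

valence : ∀ {N} → Graph N → Fin N → ℤ
valence Γ v = sumFin (λ w → ind (adj Γ v w))

-- Δ(Γ) extended linearly: Δ(Σ D_u u) = Σ D_u ((deg u) u − Σ_{w ~ u} w);
-- its coefficient at v is (deg v) D_v − Σ_{w ~ v} D_w.
Δ : ∀ {N} → Graph N → Div N → Div N
Δ Γ D v = valence Γ v ℤ.* D v ℤ.- sumFin (λ w → ind (adj Γ v w) ℤ.* D w)

-- D and E have the same class in Pic(Γ): D − E ∈ im Δ(Γ)
_∼⟨_⟩_ : ∀ {N} → Div N → Graph N → Div N → Set
D ∼⟨ Γ ⟩ E = ∃ λ F → ∀ v → D v ℤ.- E v ≡ Δ Γ F v

-- |Pic⁰(Γ)| = m : a bijection between Fin m and Pic⁰(Γ) = Div⁰/im Δ,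
-- given by a complete, irredundant list of representatives.
PicCard : ∀ {N} → Graph N → ℕ → Set
PicCard {N} Γ m =
  Σ (Fin m → Div N) λ f →
    (∀ i → deg (f i) ≡ 0ℤ) ×
    (∀ i j → f i ∼⟨ Γ ⟩ f j → i ≡ j) ×
    (∀ D → deg D ≡ 0ℤ → ∃ λ i → D ∼⟨ Γ ⟩ f i)

-- Pic⁰(Γ) has a subgroup isomorphic to (ℤ/qℤ)^r : an injective group
-- homomorphism (ℤ/qℤ)^r → Pic⁰(Γ); elements of (ℤ/qℤ)^r are represented
-- by vectors in ℤ^r, modulo q componentwise.
HasSubgroupZmodPow : ∀ {N} → Graph N → (q r : ℕ) → Set
HasSubgroupZmodPow {N} Γ q r =
  Σ ((Fin r → ℤ) → Div N) λ φ →
    (∀ a → deg (φ a) ≡ 0ℤ) ×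
    (∀ a b → (∀ i → (+ q) ∣ (a i ℤ.- b i)) → φ a ∼⟨ Γ ⟩ φ b) ×
    (∀ a b → φ (λ i → a i ℤ.+ b i) ∼⟨ Γ ⟩ (φ a ⊕ φ b)) ×
    (∀ a b → φ a ∼⟨ Γ ⟩ φ b → ∀ i → (+ q) ∣ (a i ℤ.- b i))

altSum : ∀ {N} → (Fin N → ℤ) → ℤ
altSum {zero}  f = 0ℤ
altSum {suc N} f = f zero ℤ.- altSum (λ i → f (suc i))

det : ∀ {m} → (Fin m → Fin m → ℤ) → ℤ
det {zero}  A = 1ℤ
det {suc m} A = altSum (λ j → A zero j ℤ.* det (λ i l → A (suc i) (punchIn j l)))

-- The rational Laplacian of Γ (on Div⁰(Γ) ⊗ ℚ) and its characteristic
-- polynomial evaluated at x.  For Γ on vertices Fin (suc m) we use the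
-- ℚ-basis b_i = e_i − e_last (i : Fin m) of Div⁰ ⊗ ℚ; a degree-0 divisor
-- w has coordinates w(inject₁ j) in this basis.  The matrix of the
-- operator in this basis is M j i = Δ(b_i)(inject₁ j) (integer entries),
-- and P_Γ(x) = det(x·I − M).  Convention P_Γ = 1 when Γ has one vertex
-- (empty determinant).

indEq : ∀ {N} → Fin N → Fin N → ℤ
indEq a b = ind (does (a ≟ b))

lapMatrix : ∀ {m} → Graph (suc m) → Fin m → Fin m → ℤ
lapMatrix {m} Γ j i =
  Δ Γ (λ v → indEq v (inject₁ i) ℤ.- indEq v (fromℕ m)) (inject₁ j)

charPolyAt : ∀ {k} → Graph k → ℤ → ℤ
charPolyAt {zero}  Γ x = 1ℤ
charPolyAt {suc m} Γ x = det (λ j i → x ℤ.* indEq j i ℤ.- lapMatrix Γ j i)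

module Submission where

-- For a divisor W on Γ_n with parts W_Γ and W_K (on Γ and on K_n),
--   Δ(Γ_n)W = (Δ(Γ) + n)W_Γ − deg W_K  on Γ,   Δ(Γ_n)W = q·W_K − deg W  on K_n.
-- So Δ(Γ_n) multiplies degree-0 divisors on the K_n side by q, giving the
-- subgroup; injectivity uses the maximum principle for Δ(Γ) + n.  For the
-- order, a degree-0 divisor is equivalent to exactly one representative
-- given by residues mod q at n − 1 vertices of K_n and a class in the
-- cokernel of the integer matrix N of −(Δ(Γ) + n) on Div⁰(Γ), whose
-- determinant is P_Γ(−n).  Finally a general fact, proved by clearing the
-- first row with Euclid's algorithm on columns and induction on the size:
-- the cokernel of a square integer matrix with trivial kernel has |det|
-- elements; N has trivial kernel by the maximum principle.

open import Defs
open import Data.Nat as ℕ using (ℕ; zero; suc; z≤n; s≤s; _∸_; _^_)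
import Data.Nat.Properties as ℕP
open import Data.Integer as ℤ using (ℤ; 0ℤ; 1ℤ; +_; -_; ∣_∣; _+_; _*_; _-_; _≤_)
open import Data.Integer.Properties
open import Data.Integer.Tactic.RingSolver using (solve-∀)
open import Data.Integer.DivMod using (_/_; _%_; a≡a%n+[a/n]*n; n%d<d)
open import Data.Fin as F
  using (Fin; zero; suc; toℕ; inject₁; fromℕ; _↑ˡ_; _↑ʳ_; splitAt; punchIn; punchOut; remQuot; combine)
open import Data.Fin.Properties as FP
  using (inject₁-injective; fromℕ≢inject₁; punchInᵢ≢i; punchIn-punchOut; punchIn-injective;
         toℕ-injective; toℕ-inject₁; toℕ-fromℕ<; toℕ<n; pigeonhole; remQuot-combine; combine-remQuot;
         splitAt-↑ˡ; splitAt-↑ʳ; splitAt⁻¹-↑ˡ; splitAt⁻¹-↑ʳ)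
open import Data.Sum using (_⊎_; inj₁; inj₂; [_,_]′)
open import Data.Product using (_×_; _,_; Σ; ∃; ∃₂; proj₁; proj₂; uncurry)
open import Relation.Nullary using (yes; no)
open import Relation.Binary.PropositionalEquality
open import Data.Empty using (⊥-elim)
open import Data.Vec.Functional using (_∷_)
open import Data.Bool using (true; false)
open import Data.Integer.Divisibility using () renaming (_∣_ to _∣ᵘ_)
import Data.Integer.Divisibility.Signed as Signed
open import Algebra.Properties.AbelianGroup +-0-abelianGroup using () renaming (∙-cancelˡ to +-cancelˡ)
open import Algebra.Properties.Semiring.Sum +-*-semiring
  using (sum; sum-cong-≗; ∑-distrib-+; ∑-comm; *-distribˡ-sum; sum-init-last)

sumFin≡sum : ∀ {N} (f : Fin N → ℤ) → sumFin f ≡ sum f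
sumFin≡sum {zero}  f = refl
sumFin≡sum {suc N} f = cong (_+_ (f zero)) (sumFin≡sum (λ i → f (suc i)))

sumFin-cong : ∀ {N} {f g : Fin N → ℤ} → (∀ i → f i ≡ g i) → sumFin f ≡ sumFin g
sumFin-cong {f = f} {g} f≗g =
  trans (sumFin≡sum f) (trans (sum-cong-≗ f≗g) (sym (sumFin≡sum g)))

sumFin-+ : ∀ {N} (f g : Fin N → ℤ) → sumFin (λ i → f i + g i) ≡ sumFin f + sumFin g
sumFin-+ f g = trans (sumFin≡sum (λ i → f i + g i))
  (trans (∑-distrib-+ f g) (sym (cong₂ _+_ (sumFin≡sum f) (sumFin≡sum g))))

sumFin-*ˡ : ∀ {N} (c : ℤ) (f : Fin N → ℤ) → sumFin (λ i → c * f i) ≡ c * sumFin f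
sumFin-*ˡ c f = trans (sumFin≡sum (λ i → c * f i))
  (trans (sym (*-distribˡ-sum c f)) (cong (c *_) (sym (sumFin≡sum f))))

sumFin-swap : ∀ {M N} (f : Fin M → Fin N → ℤ) →
  sumFin (λ i → sumFin (f i)) ≡ sumFin (λ j → sumFin (λ i → f i j))
sumFin-swap f = begin
  sumFin (λ i → sumFin (f i))           ≡⟨ sumFin-cong (λ i → sumFin≡sum (f i)) ⟩
  sumFin (λ i → sum (f i))              ≡⟨ sumFin≡sum (λ i → sum (f i)) ⟩
  sum (λ i → sum (f i))                 ≡⟨ ∑-comm f ⟩
  sum (λ j → sum (λ i → f i j))         ≡⟨ sumFin≡sum (λ j → sum (λ i → f i j)) ⟨
  sumFin (λ j → sum (λ i → f i j))      ≡⟨ sumFin-cong (λ j → sumFin≡sum (λ i → f i j)) ⟨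
  sumFin (λ j → sumFin (λ i → f i j))   ∎
  where open ≡-Reasoning

sumFin-last : ∀ {m} (f : Fin (suc m) → ℤ) →
  sumFin f ≡ sumFin (λ j → f (inject₁ j)) + f (fromℕ m)
sumFin-last {m} f = trans (sumFin≡sum f)
  (trans (sum-init-last f) (cong (_+ f (fromℕ m)) (sym (sumFin≡sum (λ j → f (inject₁ j))))))

sumFin-neg : ∀ {N} (f : Fin N → ℤ) → sumFin (λ i → - f i) ≡ - sumFin f
sumFin-neg f = trans (sumFin-cong (λ i → sym (-1*i≡-i (f i))))
  (trans (sumFin-*ˡ (- 1ℤ) f) (-1*i≡-i (sumFin f)))

sumFin-- : ∀ {N} (f g : Fin N → ℤ) → sumFin (λ i → f i - g i) ≡ sumFin f - sumFin g
sumFin-- f g = trans (sumFin-+ f (λ i → - g i)) (cong (_+_ (sumFin f)) (sumFin-neg g))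

sumFin-const : ∀ {N} (c : ℤ) → sumFin {N} (λ _ → c) ≡ + N * c
sumFin-const {zero}  c = sym (*-zeroˡ c)
sumFin-const {suc N} c = begin
  c + sumFin {N} (λ _ → c)   ≡⟨ cong (_+_ c) (sumFin-const {N} c) ⟩
  c + + N * c                ≡⟨ cong (_+ + N * c) (*-identityˡ c) ⟨
  1ℤ * c + + N * c           ≡⟨ *-distribʳ-+ c 1ℤ (+ N) ⟨
  (1ℤ + + N) * c             ∎
  where open ≡-Reasoning

sumFin-0 : ∀ {N} → sumFin {N} (λ _ → 0ℤ) ≡ 0ℤ
sumFin-0 {N} = trans (sumFin-const {N} 0ℤ) (*-zeroʳ (+ N))

sumFin-split : ∀ {k n} (f : Fin (k ℕ.+ n) → ℤ) →
  sumFin f ≡ sumFin (λ i → f (i ↑ˡ n)) + sumFin (λ j → f (k ↑ʳ j))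
sumFin-split {zero}  f = sym (+-identityˡ _)
sumFin-split {suc k} {n} f =
  trans (cong (_+_ (f zero)) (sumFin-split {k} {n} (λ i → f (suc i)))) (sym (+-assoc (f zero) _ _))

indEq-refl : ∀ {N} (i : Fin N) → indEq i i ≡ 1ℤ
indEq-refl i with i F.≟ i
... | yes _  = refl
... | no i≢i = ⊥-elim (i≢i refl)

indEq-≢ : ∀ {N} (i j : Fin N) → i ≢ j → indEq i j ≡ 0ℤ
indEq-≢ i j i≢j with i F.≟ j
... | yes i≡j = ⊥-elim (i≢j i≡j)
... | no _    = refl

indEq-sym : ∀ {N} (i j : Fin N) → indEq i j ≡ indEq j i
indEq-sym i j with i F.≟ j | j F.≟ i
... | yes _   | yes _   = refl
... | no _    | no _    = refl
... | yes i≡j | no j≢i  = ⊥-elim (j≢i (sym i≡j))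
... | no i≢j  | yes j≡i = ⊥-elim (i≢j (sym j≡i))

indEq-injective : ∀ {a b} (f : Fin a → Fin b) → (∀ {i j} → f i ≡ f j → i ≡ j) →
  ∀ i j → indEq (f i) (f j) ≡ indEq i j
indEq-injective f f-inj i j with f i F.≟ f j | i F.≟ j
... | yes _    | yes _   = refl
... | no _     | no _    = refl
... | yes fi≡fj | no i≢j  = ⊥-elim (i≢j (f-inj fi≡fj))
... | no fi≢fj  | yes i≡j = ⊥-elim (fi≢fj (cong f i≡j))

sumFin-delta : ∀ {N} (i : Fin N) (f : Fin N → ℤ) → sumFin (λ j → indEq i j * f j) ≡ f i
sumFin-delta {suc N} zero f = begin
  1ℤ * f zero + sumFin (λ j → 0ℤ * f (suc j))
    ≡⟨ cong₂ _+_ (*-identityˡ (f zero)) (sumFin-cong (λ j → *-zeroˡ (f (suc j)))) ⟩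
  f zero + sumFin {N} (λ _ → 0ℤ)   ≡⟨ cong (_+_ (f zero)) (sumFin-0 {N}) ⟩
  f zero + 0ℤ                      ≡⟨ +-identityʳ (f zero) ⟩
  f zero                           ∎
  where open ≡-Reasoning
sumFin-delta {suc N} (suc i) f = trans (+-identityˡ _) (sumFin-delta i (λ j → f (suc j)))

sumFin-delta′ : ∀ {N} (i : Fin N) (f : Fin N → ℤ) → sumFin (λ j → indEq j i * f j) ≡ f i
sumFin-delta′ i f = trans (sumFin-cong (λ j → cong (_* f j) (indEq-sym j i))) (sumFin-delta i f)

deg-indEq : ∀ {N} (p : Fin N) → sumFin (λ v → indEq v p) ≡ 1ℤ
deg-indEq p = trans (sumFin-cong (λ v → sym (*-identityʳ (indEq v p)))) (sumFin-delta′ p (λ _ → 1ℤ))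

module _ {N : ℕ} (Γ : Graph N) where

  private
    a : Fin N → Fin N → ℤ
    a v w = ind (adj Γ v w)

  Δ-alt : ∀ (D : Div N) v → Δ Γ D v ≡ sumFin (λ w → a v w * (D v - D w))
  Δ-alt D v = sym (begin
    sumFin (λ w → a v w * (D v - D w))
      ≡⟨ sumFin-cong (λ w → distrib (a v w) (D v) (D w)) ⟩
    sumFin (λ w → D v * a v w - a v w * D w)
      ≡⟨ sumFin-- (λ w → D v * a v w) (λ w → a v w * D w) ⟩
    sumFin (λ w → D v * a v w) - sumFin (λ w → a v w * D w)
      ≡⟨ cong (_- sumFin (λ w → a v w * D w)) (sumFin-*ˡ (D v) (a v)) ⟩
    D v * valence Γ v - sumFin (λ w → a v w * D w)
      ≡⟨ cong (_- sumFin (λ w → a v w * D w)) (*-comm (D v) (valence Γ v)) ⟩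
    Δ Γ D v ∎)
    where
    open ≡-Reasoning
    distrib : ∀ x y z → x * (y - z) ≡ y * x - x * z
    distrib = solve-∀

  Δ-cong : ∀ {D E : Div N} → (∀ v → D v ≡ E v) → ∀ v → Δ Γ D v ≡ Δ Γ E v
  Δ-cong D≗E v =
    cong₂ _-_ (cong (valence Γ v *_) (D≗E v)) (sumFin-cong (λ w → cong (a v w *_) (D≗E w)))

  Δ-lin : ∀ (x y : ℤ) (D E : Div N) v →
    Δ Γ (λ w → x * D w + y * E w) v ≡ x * Δ Γ D v + y * Δ Γ E v
  Δ-lin x y D E v = begin
    Δ Γ (λ w → x * D w + y * E w) v
      ≡⟨ Δ-alt _ v ⟩
    sumFin (λ w → a v w * ((x * D v + y * E v) - (x * D w + y * E w)))
      ≡⟨ sumFin-cong (λ w → regroup (a v w) x y (D v) (D w) (E v) (E w)) ⟩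
    sumFin (λ w → x * (a v w * (D v - D w)) + y * (a v w * (E v - E w)))
      ≡⟨ sumFin-+ {N} _ _ ⟩
    sumFin (λ w → x * (a v w * (D v - D w))) + sumFin (λ w → y * (a v w * (E v - E w)))
      ≡⟨ cong₂ _+_ (sumFin-*ˡ {N} x _) (sumFin-*ˡ {N} y _) ⟩
    x * sumFin (λ w → a v w * (D v - D w)) + y * sumFin (λ w → a v w * (E v - E w))
      ≡⟨ cong₂ (λ p r → x * p + y * r) (Δ-alt D v) (Δ-alt E v) ⟨
    x * Δ Γ D v + y * Δ Γ E v ∎
    where
    open ≡-Reasoning
    regroup : ∀ p x y dv dw ev ew →
      p * ((x * dv + y * ev) - (x * dw + y * ew)) ≡ x * (p * (dv - dw)) + y * (p * (ev - ew))
    regroup = solve-∀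

  Δ-const : ∀ (c : ℤ) v → Δ Γ (λ _ → c) v ≡ 0ℤ
  Δ-const c v = begin
    Δ Γ (λ _ → c) v                  ≡⟨ Δ-alt (λ _ → c) v ⟩
    sumFin (λ w → a v w * (c - c))   ≡⟨ sumFin-cong (λ w → cong (a v w *_) (+-inverseʳ c)) ⟩
    sumFin (λ w → a v w * 0ℤ)        ≡⟨ sumFin-cong (λ w → *-zeroʳ (a v w)) ⟩
    sumFin {N} (λ _ → 0ℤ)            ≡⟨ sumFin-0 {N} ⟩
    0ℤ                               ∎
    where open ≡-Reasoning

  -- Principal divisors have degree 0 (uses the symmetry of adjacency).
  deg-Δ : ∀ (D : Div N) → deg (Δ Γ D) ≡ 0ℤ
  deg-Δ D = begin
    sumFin (λ v → valence Γ v * D v - sumFin (λ w → a v w * D w))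
      ≡⟨ sumFin-- {N} _ _ ⟩
    sumFin (λ v → valence Γ v * D v) - sumFin (λ v → sumFin (λ w → a v w * D w))
      ≡⟨ cong₂ _-_ (sumFin-cong (λ v → trans (*-comm (valence Γ v) (D v)) (sym (sumFin-*ˡ (D v) (a v)))))
                   (sumFin-swap (λ v w → a v w * D w)) ⟩
    sumFin (λ v → sumFin (λ w → D v * a v w)) - sumFin (λ w → sumFin (λ v → a v w * D w))
      ≡⟨ cong (_-_ (sumFin (λ v → sumFin (λ w → D v * a v w))))
              (sumFin-cong (λ w → sumFin-cong (λ v →
                 trans (cong (λ b → ind b * D w) (adj-sym Γ v w)) (*-comm (a w v) (D w))))) ⟩
    sumFin (λ v → sumFin (λ w → D v * a v w)) - sumFin (λ w → sumFin (λ v → D w * a w v))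
      ≡⟨ +-inverseʳ (sumFin (λ v → sumFin (λ w → D v * a v w))) ⟩
    0ℤ ∎
    where open ≡-Reasoning

  Δ-neg : ∀ (D : Div N) v → Δ Γ (λ w → - D w) v ≡ - Δ Γ D v
  Δ-neg D v = begin
    Δ Γ (λ w → - D w) v                    ≡⟨ Δ-alt (λ w → - D w) v ⟩
    sumFin (λ w → a v w * (- D v - - D w))  ≡⟨ sumFin-cong (λ w → negate (a v w) (D v) (D w)) ⟩
    sumFin (λ w → - (a v w * (D v - D w)))  ≡⟨ sumFin-neg {N} _ ⟩
    - sumFin (λ w → a v w * (D v - D w))    ≡⟨ cong -_ (Δ-alt D v) ⟨
    - Δ Γ D v                               ∎
    where
    open ≡-Reasoning
    negate : ∀ p x y → p * (- x - - y) ≡ - (p * (x - y))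
    negate = solve-∀

  Δ-+ : ∀ (D E : Div N) v → Δ Γ (λ w → D w + E w) v ≡ Δ Γ D v + Δ Γ E v
  Δ-+ D E v = begin
    Δ Γ (λ w → D w + E w) v
      ≡⟨ Δ-cong (λ w → cong₂ _+_ (sym (*-identityˡ (D w))) (sym (*-identityˡ (E w)))) v ⟩
    Δ Γ (λ w → 1ℤ * D w + 1ℤ * E w) v    ≡⟨ Δ-lin 1ℤ 1ℤ D E v ⟩
    1ℤ * Δ Γ D v + 1ℤ * Δ Γ E v          ≡⟨ cong₂ _+_ (*-identityˡ (Δ Γ D v)) (*-identityˡ (Δ Γ E v)) ⟩
    Δ Γ D v + Δ Γ E v                    ∎
    where open ≡-Reasoning

  Δ-shift : ∀ (D : Div N) (c : ℤ) v → Δ Γ (λ w → D w - c) v ≡ Δ Γ D v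
  Δ-shift D c v = begin
    Δ Γ (λ w → D w - c) v          ≡⟨ Δ-+ D (λ _ → - c) v ⟩
    Δ Γ D v + Δ Γ (λ _ → - c) v    ≡⟨ cong (_+_ (Δ Γ D v)) (Δ-const (- c) v) ⟩
    Δ Γ D v + 0ℤ                   ≡⟨ +-identityʳ (Δ Γ D v) ⟩
    Δ Γ D v                        ∎
    where open ≡-Reasoning

  Δ-sum : ∀ {I} (x : Fin I → ℤ) (G : Fin I → Div N) w →
    Δ Γ (λ v → sumFin (λ i → x i * G i v)) w ≡ sumFin (λ i → x i * Δ Γ (G i) w)
  Δ-sum {zero}  x G w = Δ-const 0ℤ w
  Δ-sum {suc I} x G w = begin
    Δ Γ (λ v → x zero * G zero v + rest v) w
      ≡⟨ Δ-cong (λ v → cong (_+_ (x zero * G zero v)) (sym (*-identityˡ (rest v)))) w ⟩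
    Δ Γ (λ v → x zero * G zero v + 1ℤ * rest v) w
      ≡⟨ Δ-lin (x zero) 1ℤ (G zero) rest w ⟩
    x zero * Δ Γ (G zero) w + 1ℤ * Δ Γ rest w
      ≡⟨ cong (_+_ (x zero * Δ Γ (G zero) w)) (trans (*-identityˡ _) (Δ-sum (λ i → x (suc i)) (λ i → G (suc i)) w)) ⟩
    x zero * Δ Γ (G zero) w + sumFin (λ i → x (suc i) * Δ Γ (G (suc i)) w) ∎
    where
    open ≡-Reasoning
    rest : Div N
    rest v = sumFin (λ i → x (suc i) * G (suc i) v)

Δ+n : ∀ {N} → Graph N → ℕ → Div N → Div N
Δ+n Γ n D v = Δ Γ D v + + n * D v

argmax : ∀ {m} (h : Fin (suc m) → ℤ) → ∃ λ xM → ∀ x → h x ≤ h xM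
argmax {zero}  h = zero , λ { zero → ≤-refl }
argmax {suc m} h with argmax (λ x → h (suc x))
... | x′ , max′ with ≤-total (h zero) (h (suc x′))
... | inj₁ h0≤ = suc x′ , λ { zero → h0≤ ; (suc x) → max′ x }
... | inj₂ ≤h0 = zero , λ { zero → ≤-refl ; (suc x) → ≤-trans (max′ x) ≤h0 }

sumFin-nonneg : ∀ {N} (f : Fin N → ℤ) → (∀ i → 0ℤ ≤ f i) → 0ℤ ≤ sumFin f
sumFin-nonneg {zero}  f f≥0 = ≤-refl
sumFin-nonneg {suc N} f f≥0 = +-mono-≤ (f≥0 zero) (sumFin-nonneg (λ i → f (suc i)) (λ i → f≥0 (suc i)))

Δ-at-max : ∀ {N} (Γ : Graph N) (H : Div N) v → (∀ w → H w ≤ H v) → 0ℤ ≤ Δ Γ H v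
Δ-at-max Γ H v max = subst (0ℤ ≤_) (sym (Δ-alt Γ H v))
  (sumFin-nonneg _ (λ w → edge (adj Γ v w) (i≤j⇒0≤j-i (max w))))
  where
  edge : ∀ b {d} → 0ℤ ≤ d → 0ℤ ≤ ind b * d
  edge true  {d} d≥0 = subst (0ℤ ≤_) (sym (*-identityˡ d)) d≥0
  edge false {d} _   = subst (0ℤ ≤_) (sym (*-zeroˡ d)) ≤-refl

-- Maximum principle for Δ + n (one side): if (Δ + n)H is the constant B
-- then n·H ≤ B, since at a maximum of H we have n·H = B − ΔH ≤ B.
maxPrinciple-≤ : ∀ {m} (Γ : Graph (suc m)) (n : ℕ) (H : Div (suc m)) (B : ℤ) →
  (∀ x → Δ+n Γ n H x ≡ B) → ∀ x → + n * H x ≤ B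
maxPrinciple-≤ Γ n H B eq x with argmax H
... | xM , max = begin
  + n * H x               ≤⟨ *-monoˡ-≤-nonNeg (+ n) (max x) ⟩
  + n * H xM              ≡⟨ +-identityˡ (+ n * H xM) ⟨
  0ℤ + + n * H xM         ≤⟨ +-monoˡ-≤ (+ n * H xM) (Δ-at-max Γ H xM max) ⟩
  Δ Γ H xM + + n * H xM   ≡⟨ eq xM ⟩
  B                       ∎
  where open ≤-Reasoning

-- Maximum principle for Δ + n: if (Δ + n)H is constant, equal to B, then
-- n·H = B everywhere (the lower bound is the upper bound applied to −H).
maxPrinciple : ∀ {m} (Γ : Graph (suc m)) (n : ℕ) (H : Div (suc m)) (B : ℤ) →
  (∀ x → Δ+n Γ n H x ≡ B) → ∀ x → + n * H x ≡ B
maxPrinciple Γ n H B eq x = ≤-antisym (maxPrinciple-≤ Γ n H B eq x)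
  (neg-cancel-≤ (subst (_≤ - B) (sym (neg-distribʳ-* (+ n) (H x)))
    (maxPrinciple-≤ Γ n (λ v → - H v) (- B) eq⁻ x)))
  where
  eq⁻ : ∀ x → Δ+n Γ n (λ v → - H v) x ≡ - B
  eq⁻ x = begin
    Δ Γ (λ v → - H v) x + + n * - H x   ≡⟨ cong₂ _+_ (Δ-neg Γ H x) (sym (neg-distribʳ-* (+ n) (H x))) ⟩
    - Δ Γ H x + - (+ n * H x)            ≡⟨ neg-distrib-+ (Δ Γ H x) (+ n * H x) ⟨
    - (Δ Γ H x + + n * H x)              ≡⟨ cong -_ (eq x) ⟩
    - B                                  ∎
    where open ≡-Reasoning

Mat : ℕ → Set
Mat m = Fin m → Fin m → ℤ

Vec : ℕ → Set
Vec m = Fin m → ℤ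

infixl 7 _·_
_·_ : ∀ {m} → Mat m → Vec m → Vec m
(A · x) i = sumFin (λ l → A i l * x l)

·-congʳ : ∀ {m} (A : Mat m) {x y : Vec m} → (∀ l → x l ≡ y l) → ∀ i → (A · x) i ≡ (A · y) i
·-congʳ A x≗y i = sumFin-cong (λ l → cong (A i l *_) (x≗y l))

·-- : ∀ {m} (A : Mat m) (x y : Vec m) i → (A · (λ l → x l - y l)) i ≡ (A · x) i - (A · y) i
·-- {m} A x y i = trans (sumFin-cong (λ l → distrib (A i l) (x l) (y l))) (sumFin-- {m} _ _)
  where
  distrib : ∀ a x y → a * (x - y) ≡ a * x - a * y
  distrib = solve-∀

minor : ∀ {m} → Mat (suc m) → Fin (suc m) → Mat m
minor A j i l = A (suc i) (punchIn j l)

altSum-cong : ∀ {N} {f g : Fin N → ℤ} → (∀ i → f i ≡ g i) → altSum f ≡ altSum g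
altSum-cong {zero}  f≗g = refl
altSum-cong {suc N} f≗g = cong₂ _-_ (f≗g zero) (altSum-cong (λ i → f≗g (suc i)))

altSum-lin : ∀ {N} (c : ℤ) (f g : Fin N → ℤ) → altSum (λ j → f j + c * g j) ≡ altSum f + c * altSum g
altSum-lin {zero}  c f g = sym (trans (+-identityˡ _) (*-zeroʳ c))
altSum-lin {suc N} c f g =
  trans (cong (_-_ (f zero + c * g zero)) (altSum-lin c (λ j → f (suc j)) (λ j → g (suc j))))
        (regroup (f zero) c (g zero) _ _)
  where
  regroup : ∀ a c b x y → (a + c * b) - (x + c * y) ≡ (a - x) + c * (b - y)
  regroup = solve-∀

altSum-zero : ∀ {N} (f : Fin N → ℤ) → (∀ j → f j ≡ 0ℤ) → altSum f ≡ 0ℤ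
altSum-zero {zero}  f f≡0 = refl
altSum-zero {suc N} f f≡0 = cong₂ _-_ (f≡0 zero) (altSum-zero (λ j → f (suc j)) (λ j → f≡0 (suc j)))

det-cong : ∀ {m} {A B : Mat m} → (∀ i j → A i j ≡ B i j) → det A ≡ det B
det-cong {zero}  A≗B = refl
det-cong {suc m} A≗B =
  altSum-cong (λ j → cong₂ _*_ (A≗B zero j) (det-cong (λ i l → A≗B (suc i) (punchIn j l))))

record ColumnSum {m} (A B C : Mat m) (p : Fin m) (c : ℤ) : Set where
  field
    at-p  : ∀ i → A i p ≡ B i p + c * C i p
    off-B : ∀ i l → l ≢ p → A i l ≡ B i l
    off-C : ∀ i l → l ≢ p → A i l ≡ C i l

ColumnSum-minor : ∀ {m} {A B C : Mat (suc m)} {p c} → ColumnSum A B C p c → ∀ j (j≢p : j ≢ p) →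
  ColumnSum (minor A j) (minor B j) (minor C j) (punchOut j≢p) c
ColumnSum-minor {A = A} {B} {C} {p} {c} sum j j≢p = record
  { at-p  = λ i → subst (λ l → A (suc i) l ≡ B (suc i) l + c * C (suc i) l) (sym p₀↦p) (at-p (suc i))
  ; off-B = λ i l l≢p₀ → off-B (suc i) (punchIn j l) (avoids-p l l≢p₀)
  ; off-C = λ i l l≢p₀ → off-C (suc i) (punchIn j l) (avoids-p l l≢p₀) }
  where
  open ColumnSum sum
  p₀↦p : punchIn j (punchOut j≢p) ≡ p
  p₀↦p = punchIn-punchOut j≢p
  avoids-p : ∀ l → l ≢ punchOut j≢p → punchIn j l ≢ p
  avoids-p l l≢p₀ eq = l≢p₀ (punchIn-injective j l _ (trans eq (sym p₀↦p)))

-- The determinant is linear in each column.  Expanding along row 0, the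
-- term of column p is linear because the three minors there coincide; the
-- other terms are linear by induction.
det-column-linear : ∀ {m} {A B C : Mat m} {p c} → ColumnSum A B C p c → det A ≡ det B + c * det C
det-column-linear {suc m} {A} {B} {C} {p} {c} sum =
  trans (altSum-cong term) (altSum-lin c (λ j → B zero j * det (minor B j)) (λ j → C zero j * det (minor C j)))
  where
  open ≡-Reasoning
  open ColumnSum sum
  term : ∀ j → A zero j * det (minor A j) ≡ B zero j * det (minor B j) + c * (C zero j * det (minor C j))
  term j with j F.≟ p
  ... | yes refl = begin
    A zero j * det (minor A j)                     ≡⟨ cong (_* det (minor A j)) (at-p zero) ⟩
    (B zero j + c * C zero j) * det (minor A j)    ≡⟨ distrib (B zero j) c (C zero j) (det (minor A j)) ⟩
    B zero j * det (minor A j) + c * (C zero j * det (minor A j))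
      ≡⟨ cong₂ (λ dB dC → B zero j * dB + c * (C zero j * dC))
               (det-cong (λ i l → off-B (suc i) (punchIn j l) (punchInᵢ≢i j l)))
               (det-cong (λ i l → off-C (suc i) (punchIn j l) (punchInᵢ≢i j l))) ⟩
    B zero j * det (minor B j) + c * (C zero j * det (minor C j)) ∎
    where
    distrib : ∀ b c d x → (b + c * d) * x ≡ b * x + c * (d * x)
    distrib = solve-∀
  ... | no j≢p = begin
    A zero j * det (minor A j)                           ≡⟨ cong (A zero j *_) (det-column-linear (ColumnSum-minor sum j j≢p)) ⟩
    A zero j * (det (minor B j) + c * det (minor C j))   ≡⟨ distrib (A zero j) c (det (minor B j)) (det (minor C j)) ⟩
    A zero j * det (minor B j) + c * (A zero j * det (minor C j))
      ≡⟨ cong₂ (λ b c′ → b * det (minor B j) + c * (c′ * det (minor C j))) (off-B zero j j≢p) (off-C zero j j≢p) ⟩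
    B zero j * det (minor B j) + c * (C zero j * det (minor C j)) ∎
    where
    distrib : ∀ a c x y → a * (x + c * y) ≡ a * x + c * (a * y)
    distrib = solve-∀

data Adjacent : ∀ {m} → Fin m → Fin m → Set where
  first : ∀ {m} → Adjacent {suc (suc m)} zero (suc zero)
  next  : ∀ {m} {p p′ : Fin m} → Adjacent p p′ → Adjacent (suc p) (suc p′)

Adjacent-≢ : ∀ {m} {p p′ : Fin m} → Adjacent p p′ → p ≢ p′
Adjacent-≢ first    ()
Adjacent-≢ (next a) refl = Adjacent-≢ a refl

Adjacent-inject₁ : ∀ {m} (i : Fin m) → Adjacent (inject₁ i) (suc i)
Adjacent-inject₁ {suc m} zero    = first
Adjacent-inject₁ {suc m} (suc i) = next (Adjacent-inject₁ i)

punchIn-adjacent : ∀ {m} {p p′ : Fin (suc m)} → Adjacent p p′ → ∀ l →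
  punchIn p l ≡ punchIn p′ l ⊎ (punchIn p l ≡ p′ × punchIn p′ l ≡ p)
punchIn-adjacent first    zero    = inj₂ (refl , refl)
punchIn-adjacent first    (suc l) = inj₁ refl
punchIn-adjacent (next a) zero    = inj₁ refl
punchIn-adjacent (next a) (suc l) with punchIn-adjacent a l
... | inj₁ same           = inj₁ (cong suc same)
... | inj₂ (to-p′ , to-p) = inj₂ (cong suc to-p′ , cong suc to-p)

adjacent-minor : ∀ {m} {p p′ : Fin (suc m)} (j : Fin (suc m)) → Adjacent p p′ → j ≢ p → j ≢ p′ →
  ∃₂ λ q q′ → Adjacent q q′ × punchIn j q ≡ p × punchIn j q′ ≡ p′
adjacent-minor               zero          first    j≢p _    = ⊥-elim (j≢p refl)
adjacent-minor               (suc zero)    first    _   j≢p′ = ⊥-elim (j≢p′ refl)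
adjacent-minor {suc (suc _)} (suc (suc j)) first    _   _    = zero , suc zero , first , refl , refl
adjacent-minor               zero          (next a) _   _    = _ , _ , a , refl , refl
adjacent-minor {suc _}       (suc j)       (next a) j≢p j≢p′
  with adjacent-minor j a (λ eq → j≢p (cong suc eq)) (λ eq → j≢p′ (cong suc eq))
... | q , q′ , a′ , q↦p , q′↦p′ = suc q , suc q′ , next a′ , cong suc q↦p , cong suc q′↦p′

altSum-adjacent : ∀ {N} (f : Fin N → ℤ) {p p′ : Fin N} → Adjacent p p′ → f p ≡ f p′ →
  (∀ j → j ≢ p → j ≢ p′ → f j ≡ 0ℤ) → altSum f ≡ 0ℤ
altSum-adjacent f first fp≡fp′ others = begin
  f zero - (f (suc zero) - altSum (λ j → f (suc (suc j))))
    ≡⟨ cong (λ s → f zero - (f (suc zero) - s)) (altSum-zero _ (λ j → others (suc (suc j)) (λ ()) (λ ()))) ⟩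
  f zero - (f (suc zero) - 0ℤ)   ≡⟨ cong (_-_ (f zero)) (+-identityʳ (f (suc zero))) ⟩
  f zero - f (suc zero)          ≡⟨ cong (_- f (suc zero)) fp≡fp′ ⟩
  f (suc zero) - f (suc zero)    ≡⟨ +-inverseʳ (f (suc zero)) ⟩
  0ℤ                             ∎
  where open ≡-Reasoning
altSum-adjacent f (next a) fp≡fp′ others =
  cong₂ _-_ (others zero (λ ()) (λ ()))
            (altSum-adjacent (λ j → f (suc j)) a fp≡fp′
              (λ j j≢p j≢p′ → others (suc j) (λ eq → j≢p (FP.suc-injective eq))
                                             (λ eq → j≢p′ (FP.suc-injective eq))))

-- A matrix with two equal adjacent columns has determinant 0: in the
-- expansion along row 0 the two terms for these columns cancel, and every
-- other minor again has two equal adjacent columns.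
det-adjacent-columns : ∀ {m} (A : Mat m) {p p′ : Fin m} → Adjacent p p′ →
  (∀ i → A i p ≡ A i p′) → det A ≡ 0ℤ
det-adjacent-columns {suc m} A {p} {p′} a col≡ =
  altSum-adjacent (λ j → A zero j * det (minor A j)) a
    (cong₂ _*_ (col≡ zero) (det-cong minor-p≗minor-p′)) other-terms
  where
  minor-p≗minor-p′ : ∀ i l → minor A p i l ≡ minor A p′ i l
  minor-p≗minor-p′ i l with punchIn-adjacent a l
  ... | inj₁ same           = cong (A (suc i)) same
  ... | inj₂ (to-p′ , to-p) =
    trans (cong (A (suc i)) to-p′) (trans (sym (col≡ (suc i))) (cong (A (suc i)) (sym to-p)))
  other-terms : ∀ j → j ≢ p → j ≢ p′ → A zero j * det (minor A j) ≡ 0ℤ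
  other-terms j j≢p j≢p′ with adjacent-minor j a j≢p j≢p′
  ... | q , q′ , a′ , q↦p , q′↦p′ =
    trans (cong (A zero j *_) (det-adjacent-columns (minor A j) a′ col≡′)) (*-zeroʳ (A zero j))
    where
    col≡′ : ∀ i → minor A j i q ≡ minor A j i q′
    col≡′ i = trans (cong (A (suc i)) q↦p) (trans (col≡ (suc i)) (cong (A (suc i)) (sym q′↦p′)))

sumFin-bump : ∀ {N} (f g : Fin N → ℤ) (c : ℤ) (p : Fin N) →
  sumFin (λ l → (f l + c * indEq l p) * g l) ≡ sumFin (λ l → f l * g l) + c * g p
sumFin-bump {N} f g c p = begin
  sumFin (λ l → (f l + c * indEq l p) * g l)
    ≡⟨ sumFin-cong (λ l → distrib (f l) c (indEq l p) (g l)) ⟩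
  sumFin (λ l → f l * g l + c * (indEq l p * g l))
    ≡⟨ sumFin-+ {N} _ _ ⟩
  sumFin (λ l → f l * g l) + sumFin (λ l → c * (indEq l p * g l))
    ≡⟨ cong (_+_ (sumFin (λ l → f l * g l))) (trans (sumFin-*ˡ {N} c _) (cong (c *_) (sumFin-delta′ p g))) ⟩
  sumFin (λ l → f l * g l) + c * g p ∎
  where
  open ≡-Reasoning
  distrib : ∀ f c d g → (f + c * d) * g ≡ f * g + c * (d * g)
  distrib = solve-∀

-- A and B are column-equivalent: B = A·E for an integer matrix E invertible
-- over ℤ, recorded through the actions of E and E⁻¹ on vectors, together with
-- det A = det B.  This transports trivial kernels and cokernels (below).
record ColEquiv {m} (A B : Mat m) : Set where
  field
    to      : Vec m → Vec m
    to-·    : ∀ x i → (A · to x) i ≡ (B · x) i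
    to-zero : ∀ x → (∀ i → to x i ≡ 0ℤ) → ∀ i → x i ≡ 0ℤ
    from    : Vec m → Vec m
    from-·  : ∀ x i → (B · from x) i ≡ (A · x) i
    det≡    : det A ≡ det B

ColEquiv-refl : ∀ {m} (A : Mat m) → ColEquiv A A
ColEquiv-refl A = record
  { to = λ x → x ; to-· = λ x i → refl ; to-zero = λ x x≡0 → x≡0
  ; from = λ x → x ; from-· = λ x i → refl ; det≡ = refl }

ColEquiv-trans : ∀ {m} {A B C : Mat m} → ColEquiv A B → ColEquiv B C → ColEquiv A C
ColEquiv-trans A~B B~C = record
  { to      = λ x → A~B.to (B~C.to x)
  ; to-·    = λ x i → trans (A~B.to-· (B~C.to x) i) (B~C.to-· x i)
  ; to-zero = λ x x≡0 → B~C.to-zero x (A~B.to-zero (B~C.to x) x≡0)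
  ; from    = λ x → B~C.from (A~B.from x)
  ; from-·  = λ x i → trans (B~C.from-· (A~B.from x) i) (A~B.from-· x i)
  ; det≡    = trans A~B.det≡ B~C.det≡ }
  where
  module A~B = ColEquiv A~B
  module B~C = ColEquiv B~C

addToCol : ∀ {m} → Mat m → Fin m → Vec m → Mat m
addToCol A p c i l = A i l + c i * indEq l p

addToCol-at : ∀ {m} (A : Mat m) p c i → addToCol A p c i p ≡ A i p + c i
addToCol-at A p c i = trans (cong (λ d → A i p + c i * d) (indEq-refl p)) (cong (_+_ (A i p)) (*-identityʳ (c i)))

addToCol-off : ∀ {m} (A : Mat m) p c i l → l ≢ p → addToCol A p c i l ≡ A i l
addToCol-off A p c i l l≢p =
  trans (cong (λ d → A i l + c i * d) (indEq-≢ l p l≢p))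
        (trans (cong (_+_ (A i l)) (*-zeroʳ (c i))) (+-identityʳ (A i l)))

addCol : ∀ {m} → Mat m → Fin m → Fin m → ℤ → Mat m
addCol A p p′ t = addToCol A p (λ i → t * A i p′)

addCol-at : ∀ {m} (A : Mat m) p p′ t i → addCol A p p′ t i p ≡ A i p + t * A i p′
addCol-at A p p′ t = addToCol-at A p (λ i → t * A i p′)

addCol-off : ∀ {m} (A : Mat m) p p′ t i l → l ≢ p → addCol A p p′ t i l ≡ A i l
addCol-off A p p′ t = addToCol-off A p (λ i → t * A i p′)

shear : ∀ {m} → Fin m → Fin m → ℤ → Vec m → Vec m
shear p p′ t x l = x l + (t * x p) * indEq l p′

-- The shear leaves x_p itself unchanged, so shearing by −t undoes it.
shear-at-p : ∀ {m} {p p′ : Fin m} t (x : Vec m) → p ≢ p′ → shear p p′ t x p ≡ x p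
shear-at-p {p = p} {p′} t x p≢p′ =
  trans (cong (λ d → x p + (t * x p) * d) (indEq-≢ p p′ p≢p′))
        (trans (cong (_+_ (x p)) (*-zeroʳ (t * x p))) (+-identityʳ (x p)))

addCol-· : ∀ {m} (A : Mat m) p p′ t x i → (addCol A p p′ t · x) i ≡ (A · shear p p′ t x) i
addCol-· A p p′ t x i = begin
  (addCol A p p′ t · x) i
    ≡⟨ sumFin-bump (A i) x (t * A i p′) p ⟩
  (A · x) i + (t * A i p′) * x p
    ≡⟨ cong₂ _+_ (sumFin-cong (λ l → *-comm (A i l) (x l))) (reorder t (A i p′) (x p)) ⟩
  sumFin (λ l → x l * A i l) + (t * x p) * A i p′
    ≡⟨ sumFin-bump x (A i) (t * x p) p′ ⟨
  sumFin (λ l → (x l + (t * x p) * indEq l p′) * A i l)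
    ≡⟨ sumFin-cong (λ l → *-comm (shear p p′ t x l) (A i l)) ⟩
  (A · shear p p′ t x) i ∎
  where
  open ≡-Reasoning
  reorder : ∀ t a x → (t * a) * x ≡ (t * x) * a
  reorder = solve-∀

shear-inverse : ∀ {m} {p p′ : Fin m} t (x : Vec m) → p ≢ p′ → ∀ l → shear p p′ (- t) (shear p p′ t x) l ≡ x l
shear-inverse {p = p} {p′} t x p≢p′ l =
  trans (cong (λ y → shear p p′ t x l + (- t * y) * indEq l p′) (shear-at-p t x p≢p′))
        (cancel (x l) t (x p) (indEq l p′))
  where
  cancel : ∀ a t y d → (a + (t * y) * d) + (- t * y) * d ≡ a
  cancel = solve-∀

Neighbours : ∀ {m} → Fin m → Fin m → Set
Neighbours p p′ = Adjacent p p′ ⊎ Adjacent p′ p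

Neighbours-≢ : ∀ {m} {p p′ : Fin m} → Neighbours p p′ → p ≢ p′
Neighbours-≢ (inj₁ a) = Adjacent-≢ a
Neighbours-≢ (inj₂ a) p≡p′ = Adjacent-≢ a (sym p≡p′)

Neighbours-sym : ∀ {m} {p p′ : Fin m} → Neighbours p p′ → Neighbours p′ p
Neighbours-sym (inj₁ a) = inj₂ a
Neighbours-sym (inj₂ a) = inj₁ a

det-neighbour-columns : ∀ {m} (A : Mat m) {p p′ : Fin m} → Neighbours p p′ →
  (∀ i → A i p ≡ A i p′) → det A ≡ 0ℤ
det-neighbour-columns A (inj₁ a) col≡ = det-adjacent-columns A a col≡
det-neighbour-columns A (inj₂ a) col≡ = det-adjacent-columns A a (λ i → sym (col≡ i))

-- Adding a multiple of a neighbouring column preserves the determinant: by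
-- linearity in column p the change is t·det A′, where A′ is A with column p
-- replaced by column p′, and A′ has two equal adjacent columns.
det-addCol : ∀ {m} (A : Mat m) {p p′ : Fin m} t → Neighbours p p′ → det (addCol A p p′ t) ≡ det A
det-addCol {m} A {p} {p′} t nb = begin
  det (addCol A p p′ t)   ≡⟨ det-column-linear {A = addCol A p p′ t} {A} {A′} {p} {t} (record
                               { at-p = col-p ; off-B = addCol-off A p p′ t ; off-C = off-p }) ⟩
  det A + t * det A′      ≡⟨ cong (λ d → det A + t * d) (det-neighbour-columns A′ nb p≡p′-columns) ⟩
  det A + t * 0ℤ          ≡⟨ cong (_+_ (det A)) (*-zeroʳ t) ⟩
  det A + 0ℤ              ≡⟨ +-identityʳ (det A) ⟩
  det A                   ∎
  where
  open ≡-Reasoning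
  difference : Vec m
  difference i = A i p′ - A i p
  A′ : Mat m
  A′ = addToCol A p difference
  A′-at-p : ∀ i → A′ i p ≡ A i p′
  A′-at-p i = trans (addToCol-at A p difference i) (cancel (A i p) (A i p′))
    where
    cancel : ∀ a b → a + (b - a) ≡ b
    cancel = solve-∀
  col-p : ∀ i → addCol A p p′ t i p ≡ A i p + t * A′ i p
  col-p i = trans (addCol-at A p p′ t i) (cong (λ a → A i p + t * a) (sym (A′-at-p i)))
  off-p : ∀ i l → l ≢ p → addCol A p p′ t i l ≡ A′ i l
  off-p i l l≢p = trans (addCol-off A p p′ t i l l≢p) (sym (addToCol-off A p difference i l l≢p))
  p≡p′-columns : ∀ i → A′ i p ≡ A′ i p′
  p≡p′-columns i =
    trans (A′-at-p i) (sym (addToCol-off A p difference i p′ (λ p′≡p → Neighbours-≢ nb (sym p′≡p))))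

addCol-equiv : ∀ {m} (A : Mat m) {p p′ : Fin m} t → Neighbours p p′ → ColEquiv A (addCol A p p′ t)
addCol-equiv A {p} {p′} t nb = record
  { to      = shear p p′ t
  ; to-·    = λ x i → sym (addCol-· A p p′ t x i)
  ; to-zero = λ x x≡0 l → trans (sym (shear-inverse t x p≢p′ l)) (unshear-zero x x≡0 l)
  ; from    = shear p p′ (- t)
  ; from-·  = λ x i → trans (addCol-· A p p′ t (shear p p′ (- t) x) i)
                            (·-congʳ A (shear-inverse′ x) i)
  ; det≡    = sym (det-addCol A t nb) }
  where
  p≢p′ : p ≢ p′
  p≢p′ = Neighbours-≢ nb
  unshear-zero : ∀ x → (∀ l → shear p p′ t x l ≡ 0ℤ) → ∀ l → shear p p′ (- t) (shear p p′ t x) l ≡ 0ℤ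
  unshear-zero x y≡0 l =
    trans (cong₂ (λ a b → a + (- t * b) * indEq l p′) (y≡0 l) (y≡0 p)) (zero-sum (- t) (indEq l p′))
    where
    zero-sum : ∀ s d → 0ℤ + (s * 0ℤ) * d ≡ 0ℤ
    zero-sum = solve-∀
  shear-inverse′ : ∀ x l → shear p p′ t (shear p p′ (- t) x) l ≡ x l
  shear-inverse′ x l =
    trans (cong (λ s → shear p p′ s (shear p p′ (- t) x) l) (sym (neg-involutive t)))
          (shear-inverse (- t) x p≢p′ l)

ClearedAt : ∀ {m} → Mat (suc m) → Fin (suc m) → Fin (suc m) → Set
ClearedAt {m} A p p′ =
  ∃ λ B → ColEquiv A B × B zero p′ ≡ 0ℤ × (∀ i l → l ≢ p → l ≢ p′ → B i l ≡ A i l)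

-- One round of Euclid's algorithm on the row-0 entries a, b ≠ 0 at the
-- neighbouring columns p, p′: the column operations
--   (a, b) ↦ (a mod b, b) ↦ (a mod b + b, b) ↦ (a mod b + b, −(a mod b))
-- replace b by −(a mod b), which is smaller in absolute value.
euclid-round : ∀ {m} (A : Mat (suc m)) {p p′ : Fin (suc m)} → Neighbours p p′ →
  A zero p′ ≢ 0ℤ →
  ∃ λ B → ColEquiv A B × ∣ B zero p′ ∣ ℕ.< ∣ A zero p′ ∣
        × (∀ i l → l ≢ p → l ≢ p′ → B i l ≡ A i l)
euclid-round A {p} {p′} nb b≢0 =
  A₃ , ColEquiv-trans (addCol-equiv A (- q) nb)
         (ColEquiv-trans (addCol-equiv A₁ 1ℤ nb) (addCol-equiv A₂ (- 1ℤ) (Neighbours-sym nb))) ,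
  smaller , unchanged
  where
  instance
    b-nonZero : ℤ.NonZero (A zero p′)
    b-nonZero = ℤ.≢-nonZero b≢0
  a b q : ℤ
  a = A zero p
  b = A zero p′
  q = a / b
  p′≢p : p′ ≢ p
  p′≢p p′≡p = Neighbours-≢ nb (sym p′≡p)
  A₁ A₂ A₃ : Mat _
  A₁ = addCol A p p′ (- q)
  A₂ = addCol A₁ p p′ 1ℤ
  A₃ = addCol A₂ p′ p (- 1ℤ)
  A₃-at-p′ : A₃ zero p′ ≡ - + (a % b)
  A₃-at-p′ = begin
    A₃ zero p′                                  ≡⟨ addCol-at A₂ p′ p (- 1ℤ) zero ⟩
    A₂ zero p′ + - 1ℤ * A₂ zero p
      ≡⟨ cong₂ (λ u w → u + - 1ℤ * w) (addCol-off A₁ p p′ 1ℤ zero p′ p′≢p) (addCol-at A₁ p p′ 1ℤ zero) ⟩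
    A₁ zero p′ + - 1ℤ * (A₁ zero p + 1ℤ * A₁ zero p′)
      ≡⟨ cong₂ (λ u w → u + - 1ℤ * (w + 1ℤ * u)) (addCol-off A p p′ (- q) zero p′ p′≢p) (addCol-at A p p′ (- q) zero) ⟩
    b + - 1ℤ * ((a + - q * b) + 1ℤ * b)
      ≡⟨ cong (λ a′ → b + - 1ℤ * ((a′ + - q * b) + 1ℤ * b)) (a≡a%n+[a/n]*n a b) ⟩
    b + - 1ℤ * ((+ (a % b) + q * b + - q * b) + 1ℤ * b)
      ≡⟨ simplify b (+ (a % b)) q ⟩
    - + (a % b)                                 ∎
    where
    open ≡-Reasoning
    simplify : ∀ b r q → b + - 1ℤ * ((r + q * b + - q * b) + 1ℤ * b) ≡ - r
    simplify = solve-∀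
  smaller : ∣ A₃ zero p′ ∣ ℕ.< ∣ b ∣
  smaller = subst (ℕ._< ∣ b ∣) (sym (trans (cong ∣_∣ A₃-at-p′) (∣-i∣≡∣i∣ (+ (a % b))))) (n%d<d a b)
  unchanged : ∀ i l → l ≢ p → l ≢ p′ → A₃ i l ≡ A i l
  unchanged i l l≢p l≢p′ =
    trans (addCol-off A₂ p′ p (- 1ℤ) i l l≢p′)
          (trans (addCol-off A₁ p p′ 1ℤ i l l≢p) (addCol-off A p p′ (- q) i l l≢p))

-- Euclid's algorithm: repeat rounds until the entry at p′ vanishes; the
-- fuel bounds its absolute value.
euclid : ∀ {m} (A : Mat (suc m)) {p p′ : Fin (suc m)} → Neighbours p p′ →
  ∀ fuel → ∣ A zero p′ ∣ ℕ.≤ fuel → ClearedAt A p p′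
euclid A {p′ = p′} nb fuel bound with A zero p′ ℤ.≟ 0ℤ
... | yes b≡0 = A , ColEquiv-refl A , b≡0 , (λ i l _ _ → refl)
euclid A nb zero       bound | no b≢0 = ⊥-elim (b≢0 (∣i∣≡0⇒i≡0 (ℕP.n≤0⇒n≡0 bound)))
euclid A nb (suc fuel) bound | no b≢0 with euclid-round A nb b≢0
... | B , A~B , smaller , B-unchanged with euclid B nb fuel (ℕP.≤-pred (ℕP.<-≤-trans smaller bound))
... | C , B~C , C-at-p′ , C-unchanged =
  C , ColEquiv-trans A~B B~C , C-at-p′ ,
  λ i l l≢p l≢p′ → trans (C-unchanged i l l≢p l≢p′) (B-unchanged i l l≢p l≢p′)

ClearedFrom : ∀ {m} → Mat (suc m) → ℕ → Set
ClearedFrom {m} B c = ∀ (l : Fin m) → c ℕ.≤ toℕ l → B zero (suc l) ≡ 0ℤ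

-- Clearing position c + 1 with Euclid on the neighbouring columns c, c + 1
-- leaves the already cleared positions further right untouched.
clear-step : ∀ {m} (B : Mat (suc m)) c → c ℕ.< m → ClearedFrom B (suc c) →
  ∃ λ C → ColEquiv B C × ClearedFrom C c
clear-step {m} B c c<m B-cleared =
  let C , B~C , C-at-c+1 , C-unchanged = euclid B (inj₁ (Adjacent-inject₁ cᶠ)) _ ℕP.≤-refl
  in  C , B~C , C-cleared C C-at-c+1 C-unchanged
  where
  cᶠ : Fin m
  cᶠ = F.fromℕ< c<m
  toℕ-cᶠ : toℕ cᶠ ≡ c
  toℕ-cᶠ = toℕ-fromℕ< c<m
  C-cleared : ∀ C → C zero (suc cᶠ) ≡ 0ℤ →
    (∀ i l → l ≢ inject₁ cᶠ → l ≢ suc cᶠ → C i l ≡ B i l) → ClearedFrom C c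
  C-cleared C C-at-c+1 C-unchanged l c≤l with toℕ l ℕ.≟ c
  ... | yes l≡c = subst (λ l′ → C zero (suc l′) ≡ 0ℤ) (toℕ-injective (trans toℕ-cᶠ (sym l≡c))) C-at-c+1
  ... | no  l≢c = trans (C-unchanged zero (suc l) ≢c (λ eq → l≢c (trans (cong toℕ (FP.suc-injective eq)) toℕ-cᶠ)))
                        (B-cleared l c<l)
    where
    c<l : suc c ℕ.≤ toℕ l
    c<l = ℕP.≤∧≢⇒< c≤l (λ c≡l → l≢c (sym c≡l))
    ≢c : suc l ≢ inject₁ cᶠ
    ≢c eq = ℕP.<⇒≢ (ℕP.<-≤-trans c<l (ℕP.n≤1+n (toℕ l)))
                   (sym (trans (cong toℕ eq) (trans (toℕ-inject₁ cᶠ) toℕ-cᶠ)))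

clear-from : ∀ {m} (A : Mat (suc m)) d c → d ℕ.+ c ≡ m → ∃ λ B → ColEquiv A B × ClearedFrom B c
clear-from A zero c refl = A , ColEquiv-refl A , λ l m≤l → ⊥-elim (ℕP.<⇒≱ (toℕ<n l) m≤l)
clear-from A (suc d) c d+c≡m =
  let B , A~B , B-cleared = clear-from A d (suc c) (trans (ℕP.+-suc d c) d+c≡m)
      C , B~C , C-cleared = clear-step B c (subst (c ℕ.<_) d+c≡m (s≤s (ℕP.m≤n+m c d))) B-cleared
  in  C , ColEquiv-trans A~B B~C , C-cleared

clear-row : ∀ {m} (A : Mat (suc m)) → ∃ λ B → ColEquiv A B × (∀ l → B zero (suc l) ≡ 0ℤ)
clear-row {m} A =
  let B , A~B , B-cleared = clear-from A m 0 (ℕP.+-identityʳ m)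
  in  B , A~B , λ l → B-cleared l z≤n

CokerEq : ∀ {m} → Mat m → Vec m → Vec m → Set
CokerEq A u w = ∃ λ x → ∀ i → u i - w i ≡ (A · x) i

CokerEnum : ∀ {m} → Mat m → ℕ → Set
CokerEnum {m} A c =
  Σ (Fin c → Vec m) λ e → (∀ i j → CokerEq A (e i) (e j) → i ≡ j) × (∀ u → ∃ λ i → CokerEq A u (e i))

KernelFree : ∀ {m} → Mat m → Set
KernelFree {m} A = ∀ x → (∀ i → (A · x) i ≡ 0ℤ) → ∀ i → x i ≡ 0ℤ

KernelFree-equiv : ∀ {m} {A B : Mat m} → ColEquiv A B → KernelFree A → KernelFree B
KernelFree-equiv A~B A-free x Bx≡0 =
  ColEquiv.to-zero A~B x (A-free _ (λ i → trans (ColEquiv.to-· A~B x i) (Bx≡0 i)))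

CokerEnum-equiv : ∀ {m} {A B : Mat m} {c} → ColEquiv A B → CokerEnum B c → CokerEnum A c
CokerEnum-equiv A~B (e , distinct , complete) =
  e , (λ i j (x , eq) → distinct i j (ColEquiv.from A~B x , λ l → trans (eq l) (sym (ColEquiv.from-· A~B x l)))) ,
  λ u → let i , x , eq = complete u
        in  i , ColEquiv.to A~B x , λ l → trans (eq l) (sym (ColEquiv.to-· A~B x l))

bounded-multiple-zero : ∀ (a b : ℕ) (g x : ℤ) → a ℕ.< ∣ g ∣ → b ℕ.< ∣ g ∣ → + a - + b ≡ g * x → x ≡ 0ℤ
bounded-multiple-zero a b g x a<g b<g a-b≡gx with x ℤ.≟ 0ℤ
... | yes x≡0 = x≡0
... | no  x≢0 = ⊥-elim (ℕP.<-irrefl refl (ℕP.≤-<-trans g≤∣a-b∣ ∣a-b∣<g))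
  where
  instance
    ∣x∣-nonZero : ℕ.NonZero ∣ x ∣
    ∣x∣-nonZero = ℕ.≢-nonZero (λ ∣x∣≡0 → x≢0 (∣i∣≡0⇒i≡0 ∣x∣≡0))
  g≤∣a-b∣ : ∣ g ∣ ℕ.≤ ∣ + a - + b ∣
  g≤∣a-b∣ = subst (∣ g ∣ ℕ.≤_) (sym (trans (cong ∣_∣ a-b≡gx) (abs-* g x))) (ℕP.m≤m*n ∣ g ∣ ∣ x ∣)
  ∣a-b∣<g : ∣ + a - + b ∣ ℕ.< ∣ g ∣
  ∣a-b∣<g = subst (ℕ._< ∣ g ∣) (cong ∣_∣ (sym ([+m]-[+n]≡m⊖n a b)))
                  (ℕP.≤-<-trans (∣m⊝n∣≤m⊔n a b) (ℕP.⊔-lub a<g b<g))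

-- Matrices whose row 0 is (g, 0, …, 0), i.e. of block form [[g, 0], [v, M]].
-- Row 0 of B·x is g·x₀, and the rows below are v·x₀ + M·(tail x) by
-- definition of the product.
module RowCleared {m : ℕ} (B : Mat (suc m)) (cleared : ∀ l → B zero (suc l) ≡ 0ℤ) where

  g : ℤ
  g = B zero zero

  M : Mat m
  M = minor B zero

  v : Vec m
  v i = B (suc i) zero

  det-block : det B ≡ g * det M
  det-block = begin
    g * det M - altSum (λ j → B zero (suc j) * det (minor B (suc j)))
      ≡⟨ cong (_-_ (g * det M)) (altSum-zero _ (λ j → trans (cong (_* det (minor B (suc j))) (cleared j))
                                                          (*-zeroˡ (det (minor B (suc j)))))) ⟩
    g * det M - 0ℤ   ≡⟨ +-identityʳ (g * det M) ⟩
    g * det M        ∎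
    where open ≡-Reasoning

  ·-top : ∀ x → (B · x) zero ≡ g * x zero
  ·-top x = begin
    g * x zero + sumFin (λ l → B zero (suc l) * x (suc l))
      ≡⟨ cong (_+_ (g * x zero)) (sumFin-cong (λ l → trans (cong (_* x (suc l)) (cleared l)) (*-zeroˡ (x (suc l))))) ⟩
    g * x zero + sumFin {m} (λ _ → 0ℤ)   ≡⟨ cong (_+_ (g * x zero)) (sumFin-0 {m}) ⟩
    g * x zero + 0ℤ                      ≡⟨ +-identityʳ (g * x zero) ⟩
    g * x zero                           ∎
    where open ≡-Reasoning

  KernelFree-M : KernelFree B → KernelFree M
  KernelFree-M B-free z Mz≡0 i = B-free (0ℤ ∷ z) B0z≡0 (suc i)
    where
    B0z≡0 : ∀ i → (B · (0ℤ ∷ z)) i ≡ 0ℤ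
    B0z≡0 zero    = trans (·-top (0ℤ ∷ z)) (*-zeroʳ g)
    B0z≡0 (suc i) = trans (cong (_+ (M · z) i) (*-zeroʳ (v i))) (trans (+-identityˡ _) (Mz≡0 i))

  collision-kernel : g ≡ 0ℤ → ∀ (σ₁ σ₂ : ℤ) (u z₁ z₂ : Vec m) →
    (∀ i → σ₁ * v i - u i ≡ (M · z₁) i) → (∀ i → σ₂ * v i - u i ≡ (M · z₂) i) →
    ∀ i → (B · ((σ₁ - σ₂) ∷ (λ l → z₂ l - z₁ l))) i ≡ 0ℤ
  collision-kernel g≡0 σ₁ σ₂ u z₁ z₂ eq₁ eq₂ zero    =
    trans (·-top ((σ₁ - σ₂) ∷ (λ l → z₂ l - z₁ l))) (cong (_* (σ₁ - σ₂)) g≡0)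
  collision-kernel g≡0 σ₁ σ₂ u z₁ z₂ eq₁ eq₂ (suc i) = begin
    v i * (σ₁ - σ₂) + (M · (λ l → z₂ l - z₁ l)) i      ≡⟨ cong (_+_ (v i * (σ₁ - σ₂))) (·-- M z₂ z₁ i) ⟩
    v i * (σ₁ - σ₂) + ((M · z₂) i - (M · z₁) i)        ≡⟨ cong₂ (λ a b → v i * (σ₁ - σ₂) + (a - b)) (eq₂ i) (eq₁ i) ⟨
    v i * (σ₁ - σ₂) + ((σ₂ * v i - u i) - (σ₁ * v i - u i))   ≡⟨ cancel (v i) σ₁ σ₂ (u i) ⟩
    0ℤ                                                 ∎
    where
    open ≡-Reasoning
    cancel : ∀ v a b u → v * (a - b) + ((b * v - u) - (a * v - u)) ≡ 0ℤ
    cancel = solve-∀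

  -- If B has trivial kernel and M has a finite cokernel, then g ≠ 0: for
  -- g = 0, two of the c + 1 multiples 0·v, …, c·v are congruent modulo M
  -- (pigeonhole), which yields a nonzero kernel vector of B.
  pivot-nonzero : ∀ {c} → KernelFree B → CokerEnum M c → g ≢ 0ℤ
  pivot-nonzero {c} B-free (e , _ , complete) g≡0
    with pigeonhole (ℕP.n<1+n c) (λ (s : Fin (suc c)) → proj₁ (complete (λ l → + toℕ s * v l)))
  ... | s₁ , s₂ , s₁<s₂ , same-class =
    let z₁ , eq₁ = proj₂ (complete (λ l → + toℕ s₁ * v l))
        z₂ , eq₂ = proj₂ (complete (λ l → + toℕ s₂ * v l))
        eq₁′ = λ i → subst (λ k → + toℕ s₁ * v i - e k i ≡ (M · z₁) i) same-class (eq₁ i)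
        s₁≡s₂ = i-j≡0⇒i≡j _ _ (B-free ((+ toℕ s₁ - + toℕ s₂) ∷ (λ l → z₂ l - z₁ l))
                                       (collision-kernel g≡0 (+ toℕ s₁) (+ toℕ s₂) _ z₁ z₂ eq₁′ eq₂) zero)
    in  ℕP.<-irrefl (+-injective s₁≡s₂) s₁<s₂

  -- For g ≠ 0 the cokernel of B is ℤ/g × coker M, with representatives
  -- (r, e_i) for 0 ≤ r < |g| and e_i the representatives for M.
  module Block {c} (g≢0 : g ≢ 0ℤ) (enum : CokerEnum M c) where

    instance
      g-nonZero : ℤ.NonZero g
      g-nonZero = ℤ.≢-nonZero g≢0

    e : Fin c → Vec m
    e = proj₁ enum

    rep : Fin ∣ g ∣ → Fin c → Vec (suc m)
    rep r i = + toℕ r ∷ e i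

    -- Row 0 forces x₀ = 0 (and r = r′), then the rows below compare e_i, e_i′.
    rep-distinct : ∀ r i r′ i′ → CokerEq B (rep r i) (rep r′ i′) → r ≡ r′ × i ≡ i′
    rep-distinct r i r′ i′ (x , eq) = r≡r′ , i≡i′
      where
      top : + toℕ r - + toℕ r′ ≡ g * x zero
      top = trans (eq zero) (·-top x)
      x₀≡0 : x zero ≡ 0ℤ
      x₀≡0 = bounded-multiple-zero (toℕ r) (toℕ r′) g (x zero) (toℕ<n r) (toℕ<n r′) top
      r≡r′ : r ≡ r′
      r≡r′ = toℕ-injective (+-injective (i-j≡0⇒i≡j _ _ (trans top (trans (cong (g *_) x₀≡0) (*-zeroʳ g)))))
      i≡i′ : i ≡ i′
      i≡i′ = proj₁ (proj₂ enum) i i′ ((λ l → x (suc l)) , λ l →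
        trans (eq (suc l)) (trans (cong (λ y → v l * y + (M · (λ l′ → x (suc l′))) l) x₀≡0)
                                  (trans (cong (_+ (M · (λ l′ → x (suc l′))) l) (*-zeroʳ (v l))) (+-identityˡ _))))

    -- Divide u₀ by g with remainder r and quotient s, then reduce the rows
    -- below, u − s·v, modulo M.
    rep-complete : ∀ u → ∃₂ λ r i → CokerEq B u (rep r i)
    rep-complete u = r , i , x , eq
      where
      s : ℤ
      s = u zero / g
      r : Fin ∣ g ∣
      r = F.fromℕ< (n%d<d (u zero) g)
      rest : Vec m
      rest l = u (suc l) - s * v l
      i : Fin c
      i = proj₁ (proj₂ (proj₂ enum) rest)
      z : Vec m
      z = proj₁ (proj₂ (proj₂ (proj₂ enum) rest))
      z-eq : ∀ l → rest l - e i l ≡ (M · z) l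
      z-eq = proj₂ (proj₂ (proj₂ (proj₂ enum) rest))
      x : Vec (suc m)
      x = s ∷ z
      eq : ∀ l → u l - rep r i l ≡ (B · x) l
      eq zero = begin
        u zero - + toℕ r                            ≡⟨ cong (λ a → u zero - + a) (toℕ-fromℕ< (n%d<d (u zero) g)) ⟩
        u zero - + (u zero % g)                     ≡⟨ cong (_- + (u zero % g)) (a≡a%n+[a/n]*n (u zero) g) ⟩
        (+ (u zero % g) + s * g) - + (u zero % g)   ≡⟨ cancel (+ (u zero % g)) s g ⟩
        g * s                                       ≡⟨ ·-top x ⟨
        (B · x) zero                                ∎
        where
        open ≡-Reasoning
        cancel : ∀ r s g → (r + s * g) - r ≡ g * s
        cancel = solve-∀
      eq (suc l) = begin
        u (suc l) - e i l                           ≡⟨ regroup (u (suc l)) s (v l) (e i l) ⟩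
        v l * s + ((u (suc l) - s * v l) - e i l)   ≡⟨ cong (_+_ (v l * s)) (z-eq l) ⟩
        v l * s + (M · z) l                         ∎
        where
        open ≡-Reasoning
        regroup : ∀ u s v e → u - e ≡ v * s + ((u - s * v) - e)
        regroup = solve-∀

  CokerEnum-block : ∀ {c} → g ≢ 0ℤ → CokerEnum M c → CokerEnum B (∣ g ∣ ℕ.* c)
  CokerEnum-block {c} g≢0 enum = E , E-distinct , E-complete
    where
    open Block g≢0 enum
    rq : Fin (∣ g ∣ ℕ.* c) → Fin ∣ g ∣ × Fin c
    rq = remQuot {∣ g ∣} c
    E : Fin (∣ g ∣ ℕ.* c) → Vec (suc m)
    E k = rep (proj₁ (rq k)) (proj₂ (rq k))
    E-distinct : ∀ k k′ → CokerEq B (E k) (E k′) → k ≡ k′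
    E-distinct k k′ Ek≈Ek′ = begin
      k                                        ≡⟨ combine-remQuot {∣ g ∣} c k ⟨
      uncurry combine (rq k)                   ≡⟨ cong (uncurry combine) (cong₂ _,_ (proj₁ same) (proj₂ same)) ⟩
      uncurry combine (rq k′)                  ≡⟨ combine-remQuot {∣ g ∣} c k′ ⟩
      k′                                       ∎
      where
      open ≡-Reasoning
      same : proj₁ (rq k) ≡ proj₁ (rq k′) × proj₂ (rq k) ≡ proj₂ (rq k′)
      same = rep-distinct _ _ _ _ Ek≈Ek′
    E-complete : ∀ u → ∃ λ k → CokerEq B u (E k)
    E-complete u =
      let r , i , u≈rep = rep-complete u
      in  combine r i , subst (λ ri → CokerEq B u (rep (proj₁ ri) (proj₂ ri))) (sym (remQuot-combine r i)) u≈rep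

-- The cokernel of a square integer matrix with trivial kernel has exactly
-- |det A| elements: clear row 0 by column operations and induct on the size.
cokernel-size : ∀ m (A : Mat m) → KernelFree A → CokerEnum A ∣ det A ∣
cokernel-size zero    A _      = (λ _ ()) , (λ { zero zero _ → refl }) , (λ u → zero , (λ ()) , (λ ()))
cokernel-size (suc m) A A-free =
  CokerEnum-equiv A~B (subst (CokerEnum B) (sym ∣detA∣≡) (CokerEnum-block (pivot-nonzero B-free M-enum) M-enum))
  where
  B : Mat (suc m)
  B = proj₁ (clear-row A)
  A~B : ColEquiv A B
  A~B = proj₁ (proj₂ (clear-row A))
  open RowCleared B (proj₂ (proj₂ (clear-row A)))
  B-free : KernelFree B
  B-free = KernelFree-equiv A~B A-free
  M-enum : CokerEnum M ∣ det M ∣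
  M-enum = cokernel-size m M (KernelFree-M B-free)
  ∣detA∣≡ : ∣ det A ∣ ≡ ∣ g ∣ ℕ.* ∣ det M ∣
  ∣detA∣≡ = trans (cong ∣_∣ (trans (ColEquiv.det≡ A~B) det-block)) (abs-* g (det M))

last-or-inject₁ : ∀ {m} (v : Fin (suc m)) → (∃ λ j → v ≡ inject₁ j) ⊎ v ≡ fromℕ m
last-or-inject₁ {zero}  zero    = inj₂ refl
last-or-inject₁ {suc m} zero    = inj₁ (zero , refl)
last-or-inject₁ {suc m} (suc v) with last-or-inject₁ v
... | inj₁ (j , v≡j) = inj₁ (suc j , cong suc v≡j)
... | inj₂ v≡last    = inj₂ (cong suc v≡last)

Div-ext : ∀ {m} (D E : Div (suc m)) → deg D ≡ deg E → (∀ j → D (inject₁ j) ≡ E (inject₁ j)) → ∀ v → D v ≡ E v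
Div-ext {m} D E deg≡ agree v with last-or-inject₁ v
... | inj₁ (j , refl) = agree j
... | inj₂ refl       = +-cancelˡ (sumFin (λ j → D (inject₁ j))) _ _ (begin
  sumFin (λ j → D (inject₁ j)) + D (fromℕ m)   ≡⟨ sumFin-last D ⟨
  deg D                                        ≡⟨ deg≡ ⟩
  deg E                                        ≡⟨ sumFin-last E ⟩
  sumFin (λ j → E (inject₁ j)) + E (fromℕ m)   ≡⟨ cong (_+ E (fromℕ m)) (sumFin-cong agree) ⟨
  sumFin (λ j → D (inject₁ j)) + E (fromℕ m)   ∎)
  where open ≡-Reasoning

-- The basis b_i = [inject₁ i] − [last] of Div⁰, in which charPolyAt is
-- defined, and the degree-0 divisor with coordinates y in it.
basis : ∀ {m} → Fin m → Div (suc m)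
basis {m} i v = indEq v (inject₁ i) - indEq v (fromℕ m)

fromCoords : ∀ {m} → Vec m → Div (suc m)
fromCoords y v = sumFin (λ i → y i * basis i v)

fromCoords-inject₁ : ∀ {m} (y : Vec m) j → fromCoords y (inject₁ j) ≡ y j
fromCoords-inject₁ {m} y j = trans (sumFin-cong coordinate) (sumFin-delta j y)
  where
  coordinate : ∀ i → y i * basis i (inject₁ j) ≡ indEq j i * y i
  coordinate i = begin
    y i * (indEq (inject₁ j) (inject₁ i) - indEq (inject₁ j) (fromℕ m))
      ≡⟨ cong₂ (λ a b → y i * (a - b)) (indEq-injective inject₁ inject₁-injective j i)
                                        (indEq-≢ (inject₁ j) (fromℕ m) (λ eq → fromℕ≢inject₁ (sym eq))) ⟩
    y i * (indEq j i - 0ℤ)   ≡⟨ cong (y i *_) (+-identityʳ (indEq j i)) ⟩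
    y i * indEq j i          ≡⟨ *-comm (y i) (indEq j i) ⟩
    indEq j i * y i          ∎
    where open ≡-Reasoning

deg-fromCoords : ∀ {m} (y : Vec m) → deg (fromCoords y) ≡ 0ℤ
deg-fromCoords {m} y = begin
  sumFin (λ v → sumFin (λ i → y i * basis i v))   ≡⟨ sumFin-swap (λ v i → y i * basis i v) ⟩
  sumFin (λ i → sumFin (λ v → y i * basis i v))   ≡⟨ sumFin-cong (λ i → trans (sumFin-*ˡ (y i) (basis i))
                                                        (cong (y i *_) (deg-basis i))) ⟩
  sumFin (λ i → y i * 0ℤ)                         ≡⟨ sumFin-cong (λ i → *-zeroʳ (y i)) ⟩
  sumFin {m} (λ _ → 0ℤ)                           ≡⟨ sumFin-0 {m} ⟩
  0ℤ                                              ∎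
  where
  open ≡-Reasoning
  deg-basis : ∀ i → deg (basis i) ≡ 0ℤ
  deg-basis i = trans (sumFin-- (λ v → indEq v (inject₁ i)) (λ v → indEq v (fromℕ m)))
                        (cong₂ _-_ (deg-indEq (inject₁ i)) (deg-indEq (fromℕ m)))

fromCoords-lin : ∀ {m} (x z : ℤ) (a c : Vec m) v →
  fromCoords (λ t → x * a t + z * c t) v ≡ x * fromCoords a v + z * fromCoords c v
fromCoords-lin {m} x z a c v = begin
  sumFin (λ t → (x * a t + z * c t) * basis t v)
    ≡⟨ sumFin-cong (λ t → distrib x z (a t) (c t) (basis t v)) ⟩
  sumFin (λ t → x * (a t * basis t v) + z * (c t * basis t v))
    ≡⟨ sumFin-+ {m} _ _ ⟩
  sumFin (λ t → x * (a t * basis t v)) + sumFin (λ t → z * (c t * basis t v))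
    ≡⟨ cong₂ _+_ (sumFin-*ˡ x (λ t → a t * basis t v)) (sumFin-*ˡ z (λ t → c t * basis t v)) ⟩
  x * fromCoords a v + z * fromCoords c v ∎
  where
  open ≡-Reasoning
  distrib : ∀ x z a c b → (x * a + z * c) * b ≡ x * (a * b) + z * (c * b)
  distrib = solve-∀

padLast : ∀ {m} → Vec m → Div (suc m)
padLast w v = sumFin (λ t → w t * indEq v (inject₁ t))

padLast-inject₁ : ∀ {m} (w : Vec m) j → padLast w (inject₁ j) ≡ w j
padLast-inject₁ w j = trans (sumFin-cong (λ t → trans (cong (w t *_) (indEq-injective inject₁ inject₁-injective j t))
                                                     (*-comm (w t) (indEq j t))))
                            (sumFin-delta j w)

padLast-last : ∀ {m} (w : Vec m) → padLast w (fromℕ m) ≡ 0ℤ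
padLast-last {m} w = trans (sumFin-cong (λ t → trans (cong (w t *_) (indEq-≢ (fromℕ m) (inject₁ t) fromℕ≢inject₁))
                                                     (*-zeroʳ (w t))))
                           (sumFin-0 {m})

deg-padLast : ∀ {m} (w : Vec m) → deg (padLast w) ≡ sumFin w
deg-padLast {m} w = trans (sumFin-swap (λ v t → w t * indEq v (inject₁ t)))
  (sumFin-cong (λ t → trans (sumFin-*ˡ (w t) (λ v → indEq v (inject₁ t)))
                            (trans (cong (w t *_) (deg-indEq (inject₁ t))) (*-identityʳ (w t)))))

·-neg : ∀ {m} (A : Mat m) (x : Vec m) i → (A · (λ l → - x l)) i ≡ - (A · x) i
·-neg {m} A x i = trans (sumFin-cong (λ l → sym (neg-distribʳ-* (A i l) (x l)))) (sumFin-neg {m} _)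

charMatrix : ∀ {m} → Graph (suc m) → ℤ → Mat m
charMatrix Γ x j i = x * indEq j i - lapMatrix Γ j i

charMatrix-· : ∀ {m} (Γ : Graph (suc m)) x (y : Vec m) j →
  (charMatrix Γ x · y) j ≡ x * y j - Δ Γ (fromCoords y) (inject₁ j)
charMatrix-· {m} Γ x y j = begin
  sumFin (λ i → (x * indEq j i - lapMatrix Γ j i) * y i)
    ≡⟨ sumFin-cong (λ i → distrib x (indEq j i) (lapMatrix Γ j i) (y i)) ⟩
  sumFin (λ i → x * (indEq j i * y i) - y i * lapMatrix Γ j i)
    ≡⟨ sumFin-- {m} _ _ ⟩
  sumFin (λ i → x * (indEq j i * y i)) - sumFin (λ i → y i * lapMatrix Γ j i)
    ≡⟨ cong₂ _-_ (trans (sumFin-*ˡ {m} x _) (cong (x *_) (sumFin-delta j y)))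
                 (sym (Δ-sum Γ y basis (inject₁ j))) ⟩
  x * y j - Δ Γ (fromCoords y) (inject₁ j) ∎
  where
  open ≡-Reasoning
  distrib : ∀ x d l y → (x * d - l) * y ≡ x * (d * y) - y * l
  distrib = solve-∀

deg-Δ+n : ∀ {N} (Γ : Graph N) n (D : Div N) → deg D ≡ 0ℤ → deg (Δ+n Γ n D) ≡ 0ℤ
deg-Δ+n {N} Γ n D deg≡0 = begin
  sumFin (λ v → Δ Γ D v + + n * D v)        ≡⟨ sumFin-+ (Δ Γ D) (λ v → + n * D v) ⟩
  deg (Δ Γ D) + sumFin (λ v → + n * D v)    ≡⟨ cong₂ _+_ (deg-Δ Γ D) (sumFin-*ˡ (+ n) D) ⟩
  0ℤ + + n * deg D                          ≡⟨ cong (λ d → 0ℤ + + n * d) deg≡0 ⟩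
  0ℤ + + n * 0ℤ                             ≡⟨ cong (_+_ 0ℤ) (*-zeroʳ (+ n)) ⟩
  0ℤ                                        ∎
  where open ≡-Reasoning

charMatrix-Δ+n : ∀ {m} (Γ : Graph (suc m)) n (y : Vec m) j →
  (charMatrix Γ (- + n) · y) j ≡ - Δ+n Γ n (fromCoords y) (inject₁ j)
charMatrix-Δ+n Γ n y j = begin
  (charMatrix Γ (- + n) · y) j                                  ≡⟨ charMatrix-· Γ (- + n) y j ⟩
  - + n * y j - Δ Γ (fromCoords y) (inject₁ j)                  ≡⟨ cong (λ c → - + n * c - Δ Γ (fromCoords y) (inject₁ j))
                                                                        (sym (fromCoords-inject₁ y j)) ⟩
  - + n * fromCoords y (inject₁ j) - Δ Γ (fromCoords y) (inject₁ j)
    ≡⟨ regroup (+ n) (fromCoords y (inject₁ j)) (Δ Γ (fromCoords y) (inject₁ j)) ⟩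
  - Δ+n Γ n (fromCoords y) (inject₁ j)                          ∎
  where
  open ≡-Reasoning
  regroup : ∀ n c d → - n * c - d ≡ - (d + n * c)
  regroup = solve-∀

-- For n ≥ 1 the operator Δ + n is injective on Div⁰ (maximum principle), so
-- charMatrix Γ (−n) has trivial kernel.
KernelFree-charMatrix : ∀ {m} (Γ : Graph (suc m)) n → 1 ℕ.≤ n → KernelFree (charMatrix Γ (- + n))
KernelFree-charMatrix {m} Γ (suc n′) _ y Ny≡0 j = begin
  y j                        ≡⟨ fromCoords-inject₁ y j ⟨
  fromCoords y (inject₁ j)   ≡⟨ *-cancelˡ-≡ (+ suc n′) _ 0ℤ (trans (n·G≡0 (inject₁ j)) (sym (*-zeroʳ (+ suc n′)))) ⟩
  0ℤ                         ∎
  where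
  open ≡-Reasoning
  G : Div (suc m)
  G = fromCoords y
  Δ+nG≡0 : ∀ v → Δ+n Γ (suc n′) G v ≡ 0ℤ
  Δ+nG≡0 = Div-ext (Δ+n Γ (suc n′) G) (λ _ → 0ℤ)
    (trans (deg-Δ+n Γ (suc n′) G (deg-fromCoords y)) (sym (sumFin-0 {suc m})))
    (λ j → trans (sym (neg-involutive _)) (trans (cong -_ (sym (charMatrix-Δ+n Γ (suc n′) y j))) (cong -_ (Ny≡0 j))))
  n·G≡0 : ∀ v → + suc n′ * G v ≡ 0ℤ
  n·G≡0 = maxPrinciple Γ (suc n′) G 0ℤ Δ+nG≡0

∼-trans : ∀ {N} {Γ : Graph N} {D E G : Div N} → D ∼⟨ Γ ⟩ E → E ∼⟨ Γ ⟩ G → D ∼⟨ Γ ⟩ G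
∼-trans {Γ = Γ} {D} {E} {G} (F , D-E≡ΔF) (F′ , E-G≡ΔF′) = (λ w → F w + F′ w) , λ v → begin
  D v - G v                 ≡⟨ telescope (D v) (E v) (G v) ⟩
  (D v - E v) + (E v - G v) ≡⟨ cong₂ _+_ (D-E≡ΔF v) (E-G≡ΔF′ v) ⟩
  Δ Γ F v + Δ Γ F′ v        ≡⟨ Δ-+ Γ F F′ v ⟨
  Δ Γ (λ w → F w + F′ w) v  ∎
  where
  open ≡-Reasoning
  telescope : ∀ d e g → d - g ≡ (d - e) + (e - g)
  telescope = solve-∀

∼-respʳ : ∀ {N} {Γ : Graph N} {D E E′ : Div N} → (∀ v → E v ≡ E′ v) → D ∼⟨ Γ ⟩ E → D ∼⟨ Γ ⟩ E′
∼-respʳ {D = D} E≗E′ (F , D-E≡ΔF) = F , λ v → trans (cong (_-_ (D v)) (sym (E≗E′ v))) (D-E≡ΔF v)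

funToFin-cong : ∀ {a b} {r r′ : Fin a → Fin b} → (∀ t → r t ≡ r′ t) → F.funToFin r ≡ F.funToFin r′
funToFin-cong {zero}  r≗r′ = refl
funToFin-cong {suc a} r≗r′ = cong₂ combine (r≗r′ zero) (funToFin-cong (λ t → r≗r′ (suc t)))

-- A complete, irredundant family of degree-0 representatives indexed by
-- pairs (r : Fin a → Fin b, i : Fin c), with r only determined up to
-- pointwise equality, shows |Pic⁰| = b^a·c (code the pairs by Fin (b^a·c)).
PicCard-indexed : ∀ {N} (G : Graph N) {a b c} (rep : (Fin a → Fin b) → Fin c → Div N) →
  (∀ {r r′} i → (∀ t → r t ≡ r′ t) → ∀ v → rep r i v ≡ rep r′ i v) →
  (∀ r i → deg (rep r i) ≡ 0ℤ) →
  (∀ r i r′ i′ → rep r i ∼⟨ G ⟩ rep r′ i′ → (∀ t → r t ≡ r′ t) × i ≡ i′) →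
  (∀ D → deg D ≡ 0ℤ → ∃₂ λ r i → D ∼⟨ G ⟩ rep r i) →
  PicCard G (b ℕ.^ a ℕ.* c)
PicCard-indexed G {a} {b} {c} rep rep-cong deg-rep distinct complete =
  f , (λ k → deg-rep _ _) , f-distinct , f-complete
  where
  decode : Fin (b ℕ.^ a ℕ.* c) → (Fin a → Fin b) × Fin c
  decode k = F.finToFun (proj₁ (remQuot {b ℕ.^ a} c k)) , proj₂ (remQuot {b ℕ.^ a} c k)
  f : Fin (b ℕ.^ a ℕ.* c) → Div _
  f k = rep (proj₁ (decode k)) (proj₂ (decode k))
  f-distinct : ∀ k k′ → f k ∼⟨ G ⟩ f k′ → k ≡ k′
  f-distinct k k′ fk∼fk′ = begin
    k                                       ≡⟨ combine-remQuot {b ℕ.^ a} c k ⟨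
    uncurry combine (remQuot {b ℕ.^ a} c k)  ≡⟨ cong (uncurry combine) (cong₂ _,_ code≡ (proj₂ same)) ⟩
    uncurry combine (remQuot {b ℕ.^ a} c k′) ≡⟨ combine-remQuot {b ℕ.^ a} c k′ ⟩
    k′                                      ∎
    where
    open ≡-Reasoning
    same : (∀ t → proj₁ (decode k) t ≡ proj₁ (decode k′) t) × proj₂ (decode k) ≡ proj₂ (decode k′)
    same = distinct _ _ _ _ fk∼fk′
    code≡ : proj₁ (remQuot {b ℕ.^ a} c k) ≡ proj₁ (remQuot {b ℕ.^ a} c k′)
    code≡ = trans (sym (FP.funToFin-finToFin {a} {b} _))
                  (trans (funToFin-cong (proj₁ same)) (FP.funToFin-finToFin {a} {b} _))
  f-complete : ∀ D → deg D ≡ 0ℤ → ∃ λ k → D ∼⟨ G ⟩ f k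
  f-complete D deg≡0 =
    let r , i , D∼rep = complete D deg≡0
    in  combine (F.funToFin r) i , ∼-respʳ {Γ = G} {D = D} (λ v → sym (f-code r i v)) D∼rep
    where
    f-code : ∀ r i v → f (combine (F.funToFin r) i) v ≡ rep r i v
    f-code r i v = trans (cong (λ ri → rep (F.finToFun (proj₁ ri)) (proj₂ ri) v) (remQuot-combine (F.funToFin r) i))
                         (rep-cong i (FP.finToFun-funToFin r) v)

-- The join Γ_n = Γ ∨ K_n.  Its vertices are X x (x a vertex of Γ) and Y y
-- (y a vertex of K_n); a divisor on Γ_n is a pair of divisors on Γ and K_n.
module Join {k : ℕ} (Γ : Graph k) (n : ℕ) where

  X : Fin k → Fin (k ℕ.+ n)
  X x = x ↑ˡ n

  Y : Fin n → Fin (k ℕ.+ n)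
  Y y = k ↑ʳ y

  adj-XX : ∀ x x′ → adj (join Γ n) (X x) (X x′) ≡ adj Γ x x′
  adj-XX x x′ rewrite splitAt-↑ˡ k x n | splitAt-↑ˡ k x′ n = refl

  adj-XY : ∀ x y → adj (join Γ n) (X x) (Y y) ≡ true
  adj-XY x y rewrite splitAt-↑ˡ k x n | splitAt-↑ʳ k n y = refl

  adj-YX : ∀ y x → adj (join Γ n) (Y y) (X x) ≡ true
  adj-YX y x rewrite splitAt-↑ˡ k x n | splitAt-↑ʳ k n y = refl

  adj-YY : ∀ y y′ → ind (adj (join Γ n) (Y y) (Y y′)) ≡ 1ℤ - indEq y y′
  adj-YY y y′ rewrite splitAt-↑ʳ k n y | splitAt-↑ʳ k n y′ with y F.≟ y′
  ... | yes _ = refl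
  ... | no _  = refl

  pair : Div k → Div n → Div (k ℕ.+ n)
  pair G H v = [ G , H ]′ (splitAt k v)

  pair-X : ∀ G H x → pair G H (X x) ≡ G x
  pair-X G H x rewrite splitAt-↑ˡ k x n = refl

  pair-Y : ∀ G H y → pair G H (Y y) ≡ H y
  pair-Y G H y rewrite splitAt-↑ʳ k n y = refl

  join-ext : ∀ (D E : Div (k ℕ.+ n)) → (∀ x → D (X x) ≡ E (X x)) → (∀ y → D (Y y) ≡ E (Y y)) →
    ∀ v → D v ≡ E v
  join-ext D E on-X on-Y v with splitAt k v in eq
  ... | inj₁ x = subst (λ w → D w ≡ E w) (splitAt⁻¹-↑ˡ eq) (on-X x)
  ... | inj₂ y = subst (λ w → D w ≡ E w) (splitAt⁻¹-↑ʳ eq) (on-Y y)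

  deg-join : ∀ (D : Div (k ℕ.+ n)) → deg D ≡ sumFin (λ x → D (X x)) + sumFin (λ y → D (Y y))
  deg-join = sumFin-split {k} {n}

  deg-pair : ∀ G H → deg (pair G H) ≡ deg G + deg H
  deg-pair G H = trans (deg-join (pair G H)) (cong₂ _+_ (sumFin-cong (pair-X G H)) (sumFin-cong (pair-Y G H)))

  -- The Laplacian of Γ_n.  On the Γ side: (Δ(Γ) + n) applied to the Γ part,
  -- minus the degree of the K_n part, since each x is joined to all of K_n.
  Δ-join-X : ∀ (F : Div (k ℕ.+ n)) x →
    Δ (join Γ n) F (X x) ≡ Δ+n Γ n (λ x′ → F (X x′)) x - sumFin (λ y → F (Y y))
  Δ-join-X F x = begin
    Δ (join Γ n) F (X x)
      ≡⟨ trans (Δ-alt (join Γ n) F (X x)) (sumFin-split {k} {n} _) ⟩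
    sumFin (λ x′ → ind (adj (join Γ n) (X x) (X x′)) * (F (X x) - F (X x′)))
      + sumFin (λ y → ind (adj (join Γ n) (X x) (Y y)) * (F (X x) - F (Y y)))
      ≡⟨ cong₂ _+_ (trans (sumFin-cong (λ x′ → cong (λ b → ind b * (F (X x) - F (X x′))) (adj-XX x x′)))
                          (sym (Δ-alt Γ (λ x′ → F (X x′)) x)))
                   (sumFin-cong (λ y → trans (cong (λ b → ind b * (F (X x) - F (Y y))) (adj-XY x y)) (*-identityˡ _))) ⟩
    Δ Γ (λ x′ → F (X x′)) x + sumFin (λ y → F (X x) - F (Y y))
      ≡⟨ cong (_+_ (Δ Γ (λ x′ → F (X x′)) x))
              (trans (sumFin-- {n} (λ _ → F (X x)) (λ y → F (Y y))) (cong (_- ΣY) (sumFin-const {n} (F (X x))))) ⟩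
    Δ Γ (λ x′ → F (X x′)) x + (+ n * F (X x) - ΣY)
      ≡⟨ +-assoc (Δ Γ (λ x′ → F (X x′)) x) (+ n * F (X x)) (- ΣY) ⟨
    Δ+n Γ n (λ x′ → F (X x′)) x - ΣY ∎
    where
    open ≡-Reasoning
    ΣY : ℤ
    ΣY = sumFin (λ y → F (Y y))

  -- On the K_n side every y is joined to all k + n − 1 other vertices.
  Δ-join-Y : ∀ (F : Div (k ℕ.+ n)) y →
    Δ (join Γ n) F (Y y) ≡ + (n ℕ.+ k) * F (Y y) - (sumFin (λ x → F (X x)) + sumFin (λ y′ → F (Y y′)))
  Δ-join-Y F y = begin
    Δ (join Γ n) F (Y y)
      ≡⟨ trans (Δ-alt (join Γ n) F (Y y)) (sumFin-split {k} {n} _) ⟩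
    sumFin (λ x → ind (adj (join Γ n) (Y y) (X x)) * (F (Y y) - F (X x)))
      + sumFin (λ y′ → ind (adj (join Γ n) (Y y) (Y y′)) * (F (Y y) - F (Y y′)))
      ≡⟨ cong₂ _+_ (sumFin-cong (λ x → trans (cong (λ b → ind b * (F (Y y) - F (X x))) (adj-YX y x)) (*-identityˡ _)))
                   (sumFin-cong (λ y′ → cong (_* (F (Y y) - F (Y y′))) (adj-YY y y′))) ⟩
    sumFin (λ x → F (Y y) - F (X x)) + sumFin (λ y′ → (1ℤ - indEq y y′) * (F (Y y) - F (Y y′)))
      ≡⟨ cong₂ _+_ (sumFin-- {k} (λ _ → F (Y y)) (λ x → F (X x)))
                   (trans (sumFin-cong (λ y′ → distrib (indEq y y′) (F (Y y) - F (Y y′))))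
                          (sumFin-- {n} (λ y′ → F (Y y) - F (Y y′)) (λ y′ → indEq y y′ * (F (Y y) - F (Y y′))))) ⟩
    (sumFin {k} (λ _ → F (Y y)) - ΣX)
      + (sumFin (λ y′ → F (Y y) - F (Y y′)) - sumFin (λ y′ → indEq y y′ * (F (Y y) - F (Y y′))))
      ≡⟨ cong₂ (λ a b → (a - ΣX) + b) (sumFin-const {k} (F (Y y)))
               (cong₂ _-_ (trans (sumFin-- {n} (λ _ → F (Y y)) (λ y′ → F (Y y′))) (cong (_- ΣY) (sumFin-const {n} (F (Y y)))))
                          (trans (sumFin-delta y (λ y′ → F (Y y) - F (Y y′))) (+-inverseʳ (F (Y y))))) ⟩
    (+ k * F (Y y) - ΣX) + ((+ n * F (Y y) - ΣY) - 0ℤ)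
      ≡⟨ regroup (+ k) (+ n) (F (Y y)) ΣX ΣY ⟩
    (+ n + + k) * F (Y y) - (ΣX + ΣY)
      ≡⟨ cong (λ c → c * F (Y y) - (ΣX + ΣY)) (pos-+ n k) ⟨
    + (n ℕ.+ k) * F (Y y) - (ΣX + ΣY) ∎
    where
    open ≡-Reasoning
    ΣX ΣY : ℤ
    ΣX = sumFin (λ x → F (X x))
    ΣY = sumFin (λ y′ → F (Y y′))
    distrib : ∀ d a → (1ℤ - d) * a ≡ a - d * a
    distrib = solve-∀
    regroup : ∀ K N f a b → (K * f - a) + ((N * f - b) - 0ℤ) ≡ (N + K) * f - (a + b)
    regroup = solve-∀

  Δ-pair-X : ∀ G H x → Δ (join Γ n) (pair G H) (X x) ≡ Δ+n Γ n G x - deg H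
  Δ-pair-X G H x = trans (Δ-join-X (pair G H) x)
    (cong₂ _-_ (cong₂ _+_ (Δ-cong Γ (pair-X G H) x) (cong (+ n *_) (pair-X G H x)))
               (sumFin-cong (pair-Y G H)))

  Δ-pair-Y : ∀ G H y → Δ (join Γ n) (pair G H) (Y y) ≡ + (n ℕ.+ k) * H y - (deg G + deg H)
  Δ-pair-Y G H y = trans (Δ-join-Y (pair G H) y)
    (cong₂ (λ a b → + (n ℕ.+ k) * a - b) (pair-Y G H y) (cong₂ _+_ (sumFin-cong (pair-X G H)) (sumFin-cong (pair-Y G H))))

  Δ-pair-Γ : ∀ G → deg G ≡ 0ℤ → ∀ v → Δ (join Γ n) (pair G (λ _ → 0ℤ)) v ≡ pair (Δ+n Γ n G) (λ _ → 0ℤ) v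
  Δ-pair-Γ G deg≡0 = join-ext _ _ on-X on-Y
    where
    open ≡-Reasoning
    on-X : ∀ x → Δ (join Γ n) (pair G (λ _ → 0ℤ)) (X x) ≡ pair (Δ+n Γ n G) (λ _ → 0ℤ) (X x)
    on-X x = begin
      Δ (join Γ n) (pair G (λ _ → 0ℤ)) (X x)   ≡⟨ Δ-pair-X G (λ _ → 0ℤ) x ⟩
      Δ+n Γ n G x - sumFin {n} (λ _ → 0ℤ)      ≡⟨ cong (_-_ (Δ+n Γ n G x)) (sumFin-0 {n}) ⟩
      Δ+n Γ n G x - 0ℤ                         ≡⟨ +-identityʳ (Δ+n Γ n G x) ⟩
      Δ+n Γ n G x                              ≡⟨ pair-X (Δ+n Γ n G) (λ _ → 0ℤ) x ⟨
      pair (Δ+n Γ n G) (λ _ → 0ℤ) (X x)        ∎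
    on-Y : ∀ y → Δ (join Γ n) (pair G (λ _ → 0ℤ)) (Y y) ≡ pair (Δ+n Γ n G) (λ _ → 0ℤ) (Y y)
    on-Y y = begin
      Δ (join Γ n) (pair G (λ _ → 0ℤ)) (Y y)   ≡⟨ Δ-pair-Y G (λ _ → 0ℤ) y ⟩
      + (n ℕ.+ k) * 0ℤ - (deg G + sumFin {n} (λ _ → 0ℤ))
        ≡⟨ cong₂ (λ a b → + (n ℕ.+ k) * 0ℤ - (a + b)) deg≡0 (sumFin-0 {n}) ⟩
      + (n ℕ.+ k) * 0ℤ - (0ℤ + 0ℤ)             ≡⟨ trans (+-identityʳ _) (*-zeroʳ (+ (n ℕ.+ k))) ⟩
      0ℤ                                       ≡⟨ pair-Y (Δ+n Γ n G) (λ _ → 0ℤ) y ⟨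
      pair (Δ+n Γ n G) (λ _ → 0ℤ) (Y y)        ∎

module Corollary {m n′ : ℕ} (Γ : Graph (suc m)) where

  k n q : ℕ
  k = suc m
  n = suc n′
  q = n ℕ.+ k

  open Join Γ n

  -- The subgroup: a ∈ ℤ^{n−1} ↦ the degree-0 divisor on the K_n side with
  -- coordinates a.  Δ(Γ_n) acts on these divisors as multiplication by q.
  φ : Vec n′ → Div (k ℕ.+ n)
  φ a = pair (λ _ → 0ℤ) (fromCoords a)

  deg-φ : ∀ a → deg (φ a) ≡ 0ℤ
  deg-φ a = trans (deg-pair (λ _ → 0ℤ) (fromCoords a)) (cong₂ _+_ (sumFin-0 {k}) (deg-fromCoords a))

  Δ-φ : ∀ w v → Δ (join Γ n) (φ w) v ≡ + q * φ w v
  Δ-φ w = join-ext _ _ on-X on-Y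
    where
    on-X : ∀ x → Δ (join Γ n) (φ w) (X x) ≡ + q * φ w (X x)
    on-X x = begin
      Δ (join Γ n) (φ w) (X x)                          ≡⟨ Δ-pair-X (λ _ → 0ℤ) (fromCoords w) x ⟩
      Δ+n Γ n (λ _ → 0ℤ) x - deg (fromCoords w)         ≡⟨ cong₂ (λ a b → (a + + n * 0ℤ) - b) (Δ-const Γ 0ℤ x) (deg-fromCoords w) ⟩
      (0ℤ + + n * 0ℤ) - 0ℤ                              ≡⟨ vanish (+ n) (+ q) ⟩
      + q * 0ℤ                                          ≡⟨ cong (+ q *_) (pair-X (λ _ → 0ℤ) (fromCoords w) x) ⟨
      + q * φ w (X x)                                   ∎
      where
      open ≡-Reasoning
      vanish : ∀ a b → (0ℤ + a * 0ℤ) - 0ℤ ≡ b * 0ℤ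
      vanish = solve-∀
    on-Y : ∀ y → Δ (join Γ n) (φ w) (Y y) ≡ + q * φ w (Y y)
    on-Y y = begin
      Δ (join Γ n) (φ w) (Y y)                                        ≡⟨ Δ-pair-Y (λ _ → 0ℤ) (fromCoords w) y ⟩
      + q * fromCoords w y - (sumFin {k} (λ _ → 0ℤ) + deg (fromCoords w))
        ≡⟨ cong₂ (λ a b → + q * fromCoords w y - (a + b)) (sumFin-0 {k}) (deg-fromCoords w) ⟩
      + q * fromCoords w y - 0ℤ                                       ≡⟨ +-identityʳ (+ q * fromCoords w y) ⟩
      + q * fromCoords w y                                            ≡⟨ cong (+ q *_) (pair-Y (λ _ → 0ℤ) (fromCoords w) y) ⟨
      + q * φ w (Y y)                                                 ∎
      where open ≡-Reasoning

  -- Vectors congruent modulo q give linearly equivalent divisors: their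
  -- difference is φ(q·w) = q·φ(w) = Δ(φ w).
  φ-mod-q : ∀ a c → (∀ t → + q ∣ᵘ (a t - c t)) → φ a ∼⟨ join Γ n ⟩ φ c
  φ-mod-q a c q∣a-c = φ w , λ v → trans (difference v) (sym (Δ-φ w v))
    where
    w : Vec n′
    w t = Signed._∣_.quotient (Signed.∣ᵤ⇒∣ {+ q} {a t - c t} (q∣a-c t))
    a-c≡wq : ∀ t → a t - c t ≡ w t * + q
    a-c≡wq t = Signed._∣_.equality (Signed.∣ᵤ⇒∣ {+ q} {a t - c t} (q∣a-c t))
    difference : ∀ v → φ a v - φ c v ≡ + q * φ w v
    difference = join-ext _ _
      (λ x → trans (cong₂ _-_ (pair-X _ _ x) (pair-X _ _ x)) (trans (vanish (+ q)) (cong (+ q *_) (sym (pair-X _ _ x)))))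
      (λ y → begin
        φ a (Y y) - φ c (Y y)                           ≡⟨ cong₂ _-_ (pair-Y _ _ y) (pair-Y _ _ y) ⟩
        fromCoords a y - fromCoords c y                 ≡⟨ regroup (fromCoords a y) (fromCoords c y) ⟩
        1ℤ * fromCoords a y + - 1ℤ * fromCoords c y     ≡⟨ fromCoords-lin 1ℤ (- 1ℤ) a c y ⟨
        fromCoords (λ t → 1ℤ * a t + - 1ℤ * c t) y
          ≡⟨ sumFin-cong (λ t → cong (_* basis t y) (trans (*-comm (+ q) (w t)) (trans (sym (a-c≡wq t)) (regroup (a t) (c t))))) ⟨
        fromCoords (λ t → + q * w t) y                  ≡⟨ sumFin-cong (λ t → *-assoc (+ q) (w t) (basis t y)) ⟩
        sumFin (λ t → + q * (w t * basis t y))          ≡⟨ sumFin-*ˡ (+ q) (λ t → w t * basis t y) ⟩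
        + q * fromCoords w y                            ≡⟨ cong (+ q *_) (pair-Y _ _ y) ⟨
        + q * φ w (Y y)                                 ∎)
      where
      open ≡-Reasoning
      vanish : ∀ b → 0ℤ - 0ℤ ≡ b * 0ℤ
      vanish = solve-∀
      regroup : ∀ a c → a - c ≡ 1ℤ * a + - 1ℤ * c
      regroup = solve-∀

  φ-hom : ∀ a c → φ (λ t → a t + c t) ∼⟨ join Γ n ⟩ (φ a ⊕ φ c)
  φ-hom a c = (λ _ → 0ℤ) , λ v → trans (difference v) (sym (Δ-const (join Γ n) 0ℤ v))
    where
    difference : ∀ v → φ (λ t → a t + c t) v - (φ a ⊕ φ c) v ≡ 0ℤ
    difference = join-ext _ _
      (λ x → cong₂ (λ u w → u - w) (pair-X _ _ x) (cong₂ _+_ (pair-X _ _ x) (pair-X _ _ x)))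
      (λ y → begin
        φ (λ t → a t + c t) (Y y) - (φ a (Y y) + φ c (Y y))
          ≡⟨ cong₂ (λ u w → u - w) (pair-Y _ _ y) (cong₂ _+_ (pair-Y _ _ y) (pair-Y _ _ y)) ⟩
        fromCoords (λ t → a t + c t) y - (fromCoords a y + fromCoords c y)
          ≡⟨ cong (_- (fromCoords a y + fromCoords c y))
                  (trans (sumFin-cong (λ t → cong (_* basis t y) (cong₂ _+_ (sym (*-identityˡ (a t))) (sym (*-identityˡ (c t))))))
                         (fromCoords-lin 1ℤ 1ℤ a c y)) ⟩
        (1ℤ * fromCoords a y + 1ℤ * fromCoords c y) - (fromCoords a y + fromCoords c y)
          ≡⟨ cancel (fromCoords a y) (fromCoords c y) ⟩
        0ℤ ∎)
      where
      open ≡-Reasoning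
      cancel : ∀ a c → (1ℤ * a + 1ℤ * c) - (a + c) ≡ 0ℤ
      cancel = solve-∀

  -- Injectivity: if φ a − φ c = ΔW, then ΔW vanishes on the Γ side, so by
  -- the maximum principle W is constant (= F₀) there; the degrees then force
  -- a_t − c_t = q·(W(y_t) − F₀).
  φ-injective : ∀ a c → φ a ∼⟨ join Γ n ⟩ φ c → ∀ t → + q ∣ᵘ (a t - c t)
  φ-injective a c (W , eq) t = Signed.∣⇒∣ᵤ (Signed.divides (W (Y (inject₁ t)) - F₀) a-c≡)
    where
    open ≡-Reasoning
    WX : Div k
    WX x = W (X x)
    ΣX ΣY F₀ : ℤ
    ΣX = sumFin WX
    ΣY = sumFin (λ y → W (Y y))
    F₀ = WX zero
    harmonic : ∀ x → Δ+n Γ n WX x ≡ ΣY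
    harmonic x = sym (i-j≡0⇒i≡j ΣY (Δ+n Γ n WX x) (begin
      ΣY - Δ+n Γ n WX x                  ≡⟨ flip (Δ+n Γ n WX x) ΣY ⟩
      - (Δ+n Γ n WX x - ΣY)              ≡⟨ cong -_ (sym (Δ-join-X W x)) ⟩
      - Δ (join Γ n) W (X x)             ≡⟨ cong -_ (sym (eq (X x))) ⟩
      - (φ a (X x) - φ c (X x))          ≡⟨ cong -_ (cong₂ _-_ (pair-X _ _ x) (pair-X _ _ x)) ⟩
      0ℤ                                 ∎))
      where
      flip : ∀ d s → s - d ≡ - (d - s)
      flip = solve-∀
    n·WX≡ΣY : ∀ x → + n * WX x ≡ ΣY
    n·WX≡ΣY = maxPrinciple Γ n WX ΣY harmonic
    WX≡F₀ : ∀ x → WX x ≡ F₀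
    WX≡F₀ x = *-cancelˡ-≡ (+ n) (WX x) F₀ (trans (n·WX≡ΣY x) (sym (n·WX≡ΣY zero)))
    total : ΣX + ΣY ≡ + q * F₀
    total = begin
      ΣX + ΣY                        ≡⟨ cong₂ _+_ (trans (sumFin-cong WX≡F₀) (sumFin-const {k} F₀)) (sym (n·WX≡ΣY zero)) ⟩
      + k * F₀ + + n * F₀            ≡⟨ *-distribʳ-+ F₀ (+ k) (+ n) ⟨
      (+ k + + n) * F₀               ≡⟨ cong (_* F₀) (trans (+-comm (+ k) (+ n)) (sym (pos-+ n k))) ⟩
      + q * F₀                       ∎
    a-c≡ : a t - c t ≡ (W (Y (inject₁ t)) - F₀) * + q
    a-c≡ = begin
      a t - c t                                       ≡⟨ cong₂ _-_ (fromCoords-inject₁ a t) (fromCoords-inject₁ c t) ⟨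
      fromCoords a (inject₁ t) - fromCoords c (inject₁ t)
        ≡⟨ cong₂ _-_ (pair-Y _ _ (inject₁ t)) (pair-Y _ _ (inject₁ t)) ⟨
      φ a (Y (inject₁ t)) - φ c (Y (inject₁ t))       ≡⟨ eq (Y (inject₁ t)) ⟩
      Δ (join Γ n) W (Y (inject₁ t))                  ≡⟨ Δ-join-Y W (inject₁ t) ⟩
      + q * W (Y (inject₁ t)) - (ΣX + ΣY)             ≡⟨ cong (_-_ (+ q * W (Y (inject₁ t)))) total ⟩
      + q * W (Y (inject₁ t)) - + q * F₀              ≡⟨ factor (+ q) (W (Y (inject₁ t))) F₀ ⟩
      (W (Y (inject₁ t)) - F₀) * + q                  ∎
      where
      factor : ∀ q w f → q * w - q * f ≡ (w - f) * q
      factor = solve-∀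

  subgroup : HasSubgroupZmodPow (join Γ n) q n′
  subgroup = φ , deg-φ , φ-mod-q , φ-hom , φ-injective

  -- Pic⁰(Γ_n).  Representatives are indexed by residues r ∈ [0, q)^{n−1} on
  -- the K_n side and a representative e_i of the cokernel of
  -- N = charMatrix Γ (−n) on the Γ side.
  module Representatives {c : ℕ} (enum : CokerEnum (charMatrix Γ (- + n)) c) where

    N : Mat m
    N = charMatrix Γ (- + n)

    e : Fin c → Vec m
    e = proj₁ enum

    residues : (Fin n′ → Fin q) → Vec n′
    residues r t = + toℕ (r t)

    ρ : (Fin n′ → Fin q) → ℤ
    ρ r = sumFin (residues r)

    -- Γ side: e_i in the basis b, corrected at the last vertex to make the
    -- total degree 0.  K_n side: the residues, and 0 at the last vertex.
    repΓ : (Fin n′ → Fin q) → Fin c → Div k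
    repΓ r i x = fromCoords (e i) x - ρ r * indEq x (fromℕ m)

    rep : (Fin n′ → Fin q) → Fin c → Div (k ℕ.+ n)
    rep r i = pair (repΓ r i) (padLast (residues r))

    repΓ-inject₁ : ∀ r i j → repΓ r i (inject₁ j) ≡ e i j
    repΓ-inject₁ r i j = begin
      fromCoords (e i) (inject₁ j) - ρ r * indEq (inject₁ j) (fromℕ m)
        ≡⟨ cong₂ (λ a b → a - ρ r * b) (fromCoords-inject₁ (e i) j) (indEq-≢ (inject₁ j) (fromℕ m) (λ eq → fromℕ≢inject₁ (sym eq))) ⟩
      e i j - ρ r * 0ℤ   ≡⟨ cong (λ a → e i j - a) (*-zeroʳ (ρ r)) ⟩
      e i j - 0ℤ         ≡⟨ +-identityʳ (e i j) ⟩
      e i j              ∎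
      where open ≡-Reasoning

    deg-repΓ : ∀ r i → deg (repΓ r i) ≡ - ρ r
    deg-repΓ r i = begin
      deg (repΓ r i)                                                  ≡⟨ sumFin-- (fromCoords (e i)) (λ x → ρ r * indEq x (fromℕ m)) ⟩
      deg (fromCoords (e i)) - sumFin (λ x → ρ r * indEq x (fromℕ m))
        ≡⟨ cong₂ _-_ (deg-fromCoords (e i)) (trans (sumFin-*ˡ (ρ r) (λ x → indEq x (fromℕ m))) (cong (ρ r *_) (deg-indEq (fromℕ m)))) ⟩
      0ℤ - ρ r * 1ℤ                                                   ≡⟨ trans (+-identityˡ _) (cong -_ (*-identityʳ (ρ r))) ⟩
      - ρ r                                                           ∎
      where open ≡-Reasoning

    deg-rep : ∀ r i → deg (rep r i) ≡ 0ℤ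
    deg-rep r i = begin
      deg (rep r i)                                 ≡⟨ deg-pair (repΓ r i) (padLast (residues r)) ⟩
      deg (repΓ r i) + deg (padLast (residues r))   ≡⟨ cong₂ _+_ (deg-repΓ r i) (deg-padLast (residues r)) ⟩
      - ρ r + ρ r                                   ≡⟨ +-inverseˡ (ρ r) ⟩
      0ℤ                                            ∎
      where open ≡-Reasoning

    rep-cong : ∀ {r r′} i → (∀ t → r t ≡ r′ t) → ∀ v → rep r i v ≡ rep r′ i v
    rep-cong {r} {r′} i r≗r′ = join-ext _ _
      (λ x → trans (pair-X _ _ x) (trans (cong (λ p → fromCoords (e i) x - p * indEq x (fromℕ m)) ρ≡)
                                         (sym (pair-X _ _ x))))
      (λ y → trans (pair-Y _ _ y) (trans (sumFin-cong (λ t → cong (λ s → + toℕ s * indEq y (inject₁ t)) (r≗r′ t)))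
                                         (sym (pair-Y _ _ y))))
      where
      ρ≡ : ρ r ≡ ρ r′
      ρ≡ = sumFin-cong (λ t → cong (λ s → + toℕ s) (r≗r′ t))

    -- On the K_n side an equivalence rep r i − rep r′ i′ = ΔW reads
    -- r_t − r′_t = q·(W(y_t) − W(y_last)): the residues agree and W is
    -- constant on K_n.
    K_n-side : ∀ r i r′ i′ W → (∀ v → rep r i v - rep r′ i′ v ≡ Δ (join Γ n) W v) →
      (∀ t → r t ≡ r′ t) × (∀ y → W (Y y) ≡ W (Y (fromℕ n′)))
    K_n-side r i r′ i′ W eq = r≗r′ , constant
      where
      open ≡-Reasoning
      f S : ℤ
      f = W (Y (fromℕ n′))
      S = sumFin (λ x → W (X x)) + sumFin (λ y → W (Y y))
      on-Y : ∀ y → padLast (residues r) y - padLast (residues r′) y ≡ + q * W (Y y) - S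
      on-Y y = trans (cong₂ _-_ (sym (pair-Y _ _ y)) (sym (pair-Y _ _ y))) (trans (eq (Y y)) (Δ-join-Y W y))
      S≡qf : S ≡ + q * f
      S≡qf = sym (i-j≡0⇒i≡j (+ q * f) S (sym (begin
        0ℤ - 0ℤ                                                               ≡⟨ cong₂ _-_ (padLast-last (residues r)) (padLast-last (residues r′)) ⟨
        padLast (residues r) (fromℕ n′) - padLast (residues r′) (fromℕ n′)    ≡⟨ on-Y (fromℕ n′) ⟩
        + q * f - S                                                           ∎)))
      residue-difference : ∀ t → + toℕ (r t) - + toℕ (r′ t) ≡ + q * (W (Y (inject₁ t)) - f)
      residue-difference t = begin
        + toℕ (r t) - + toℕ (r′ t)
          ≡⟨ cong₂ _-_ (padLast-inject₁ (residues r) t) (padLast-inject₁ (residues r′) t) ⟨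
        padLast (residues r) (inject₁ t) - padLast (residues r′) (inject₁ t)  ≡⟨ on-Y (inject₁ t) ⟩
        + q * W (Y (inject₁ t)) - S                                           ≡⟨ cong (_-_ (+ q * W (Y (inject₁ t)))) S≡qf ⟩
        + q * W (Y (inject₁ t)) - + q * f                                     ≡⟨ factor (+ q) (W (Y (inject₁ t))) f ⟩
        + q * (W (Y (inject₁ t)) - f)                                         ∎
        where
        factor : ∀ q w f → q * w - q * f ≡ q * (w - f)
        factor = solve-∀
      flat : ∀ t → W (Y (inject₁ t)) - f ≡ 0ℤ
      flat t = bounded-multiple-zero (toℕ (r t)) (toℕ (r′ t)) (+ q) _ (toℕ<n (r t)) (toℕ<n (r′ t)) (residue-difference t)
      r≗r′ : ∀ t → r t ≡ r′ t
      r≗r′ t = toℕ-injective (+-injective (i-j≡0⇒i≡j _ _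
        (trans (residue-difference t) (trans (cong (+ q *_) (flat t)) (*-zeroʳ (+ q))))))
      constant : ∀ y → W (Y y) ≡ f
      constant y with last-or-inject₁ y
      ... | inj₁ (t , refl) = i-j≡0⇒i≡j _ _ (flat t)
      ... | inj₂ refl       = refl

    -- With r = r′ and
    -- W constant (= f) on K_n, the divisor G = W − f on the Γ side has
    -- degree 0 and the same Laplacian as W, so on the Γ side
    -- e_i − e_i′ = (Δ + n)G = N·(−g) for the coordinates g of G.
    rep-distinct : ∀ r i r′ i′ → rep r i ∼⟨ join Γ n ⟩ rep r′ i′ → (∀ t → r t ≡ r′ t) × i ≡ i′
    rep-distinct r i r′ i′ (W , eq) = proj₁ (K_n-side r i r′ i′ W eq) , i≡i′
      where
      open ≡-Reasoning
      f : ℤ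
      f = W (Y (fromℕ n′))
      G : Div k
      G x = W (X x) - f
      ΔW≡ΔG : ∀ v → Δ (join Γ n) W v ≡ Δ (join Γ n) (pair G (λ _ → 0ℤ)) v
      ΔW≡ΔG v = trans (sym (Δ-shift (join Γ n) W f v)) (Δ-cong (join Γ n) W-shifted v)
        where
        W-shifted : ∀ v → W v - f ≡ pair G (λ _ → 0ℤ) v
        W-shifted = join-ext _ _ (λ x → sym (pair-X _ _ x))
          (λ y → trans (trans (cong (_- f) (proj₂ (K_n-side r i r′ i′ W eq) y)) (+-inverseʳ f)) (sym (pair-Y _ _ y)))
      deg-G : deg G ≡ 0ℤ
      deg-G = neg-injective (begin
        - deg G                                                ≡⟨ cong -_ (+-identityʳ (deg G)) ⟨
        - (deg G + 0ℤ)                                         ≡⟨ +-identityˡ _ ⟨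
        0ℤ - (deg G + 0ℤ)                                      ≡⟨ cong₂ (λ a b → a - (deg G + b)) (*-zeroʳ (+ q)) (sumFin-0 {n}) ⟨
        + q * 0ℤ - (deg G + sumFin {n} (λ _ → 0ℤ))             ≡⟨ Δ-pair-Y G (λ _ → 0ℤ) (fromℕ n′) ⟨
        Δ (join Γ n) (pair G (λ _ → 0ℤ)) (Y (fromℕ n′))       ≡⟨ ΔW≡ΔG (Y (fromℕ n′)) ⟨
        Δ (join Γ n) W (Y (fromℕ n′))                         ≡⟨ eq (Y (fromℕ n′)) ⟨
        rep r i (Y (fromℕ n′)) - rep r′ i′ (Y (fromℕ n′))     ≡⟨ cong₂ _-_ (pair-Y _ _ (fromℕ n′)) (pair-Y _ _ (fromℕ n′)) ⟩
        padLast (residues r) (fromℕ n′) - padLast (residues r′) (fromℕ n′)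
          ≡⟨ cong₂ _-_ (padLast-last (residues r)) (padLast-last (residues r′)) ⟩
        0ℤ                                                     ∎)
      g : Vec m
      g j = G (inject₁ j)
      G≗g : ∀ v → G v ≡ fromCoords g v
      G≗g = Div-ext G (fromCoords g) (trans deg-G (sym (deg-fromCoords g))) (λ j → sym (fromCoords-inject₁ g j))
      i≡i′ : i ≡ i′
      i≡i′ = proj₁ (proj₂ enum) i i′ ((λ j → - g j) , λ j → begin
        e i j - e i′ j                                         ≡⟨ cong₂ _-_ (repΓ-inject₁ r i j) (repΓ-inject₁ r′ i′ j) ⟨
        repΓ r i (inject₁ j) - repΓ r′ i′ (inject₁ j)          ≡⟨ cong₂ _-_ (pair-X _ _ (inject₁ j)) (pair-X _ _ (inject₁ j)) ⟨
        rep r i (X (inject₁ j)) - rep r′ i′ (X (inject₁ j))    ≡⟨ trans (eq (X (inject₁ j))) (ΔW≡ΔG (X (inject₁ j))) ⟩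
        Δ (join Γ n) (pair G (λ _ → 0ℤ)) (X (inject₁ j))       ≡⟨ trans (Δ-pair-Γ G deg-G (X (inject₁ j))) (pair-X _ _ (inject₁ j)) ⟩
        Δ+n Γ n G (inject₁ j)                                  ≡⟨ cong₂ _+_ (Δ-cong Γ G≗g (inject₁ j)) (cong (+ n *_) (G≗g (inject₁ j))) ⟩
        Δ+n Γ n (fromCoords g) (inject₁ j)                     ≡⟨ neg-involutive _ ⟨
        - - Δ+n Γ n (fromCoords g) (inject₁ j)                 ≡⟨ cong -_ (charMatrix-Δ+n Γ n g j) ⟨
        - (N · g) j                                            ≡⟨ ·-neg N g j ⟨
        (N · (λ l → - g l)) j                                  ∎)

    -- A degree-0 divisor D whose K_n side is already padLast (residues r) is
    -- equivalent to some rep r i: on the Γ side D − repΓ r i is a degree-0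
    -- divisor K with coordinates h − e_i = N·z, and K = (Δ + n)(fromCoords (−z)).
    reach-rep : ∀ r (D : Div (k ℕ.+ n)) → deg D ≡ 0ℤ → (∀ y → D (Y y) ≡ padLast (residues r) y) →
      ∃ λ i → D ∼⟨ join Γ n ⟩ rep r i
    reach-rep r D deg≡0 on-Y =
      i , pair G (λ _ → 0ℤ) , λ v → trans (difference v) (sym (Δ-pair-Γ G (deg-fromCoords (λ l → - z l)) v))
      where
      open ≡-Reasoning
      h : Vec m
      h j = D (X (inject₁ j))
      i : Fin c
      i = proj₁ (proj₂ (proj₂ enum) h)
      z : Vec m
      z = proj₁ (proj₂ (proj₂ (proj₂ enum) h))
      h-e≡Nz : ∀ j → h j - e i j ≡ (N · z) j
      h-e≡Nz = proj₂ (proj₂ (proj₂ (proj₂ enum) h))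
      G : Div k
      G = fromCoords (λ l → - z l)
      K : Div k
      K x = D (X x) - repΓ r i x
      deg-K : deg K ≡ 0ℤ
      deg-K = begin
        deg K                                                         ≡⟨ sumFin-- (λ x → D (X x)) (repΓ r i) ⟩
        sumFin (λ x → D (X x)) - deg (repΓ r i)                       ≡⟨ cong (_-_ (sumFin (λ x → D (X x)))) (deg-repΓ r i) ⟩
        sumFin (λ x → D (X x)) - - ρ r                                ≡⟨ cong (_+_ (sumFin (λ x → D (X x)))) (neg-involutive (ρ r)) ⟩
        sumFin (λ x → D (X x)) + ρ r                                  ≡⟨ cong (_+_ (sumFin (λ x → D (X x))))
                                                                               (trans (sym (deg-padLast (residues r))) (sumFin-cong (λ y → sym (on-Y y)))) ⟩
        sumFin (λ x → D (X x)) + sumFin (λ y → D (Y y))               ≡⟨ deg-join D ⟨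
        deg D                                                         ≡⟨ deg≡0 ⟩
        0ℤ                                                            ∎
      K≗Δ+nG : ∀ x → K x ≡ Δ+n Γ n G x
      K≗Δ+nG = Div-ext K (Δ+n Γ n G) (trans deg-K (sym (deg-Δ+n Γ n G (deg-fromCoords (λ l → - z l))))) λ j → begin
        D (X (inject₁ j)) - repΓ r i (inject₁ j)    ≡⟨ cong (_-_ (h j)) (repΓ-inject₁ r i j) ⟩
        h j - e i j                                 ≡⟨ h-e≡Nz j ⟩
        (N · z) j                                   ≡⟨ neg-involutive _ ⟨
        - - (N · z) j                               ≡⟨ cong -_ (·-neg N z j) ⟨
        - (N · (λ l → - z l)) j                     ≡⟨ cong -_ (charMatrix-Δ+n Γ n (λ l → - z l) j) ⟩
        - - Δ+n Γ n G (inject₁ j)                   ≡⟨ neg-involutive _ ⟩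
        Δ+n Γ n G (inject₁ j)                       ∎
      difference : ∀ v → D v - rep r i v ≡ pair (Δ+n Γ n G) (λ _ → 0ℤ) v
      difference = join-ext _ _
        (λ x → trans (cong (_-_ (D (X x))) (pair-X _ _ x)) (trans (K≗Δ+nG x) (sym (pair-X _ _ x))))
        (λ y → trans (cong₂ _-_ (on-Y y) (pair-Y _ _ y)) (trans (+-inverseʳ (padLast (residues r) y)) (sym (pair-Y _ _ y))))

    -- Every divisor D is equivalent to one whose K_n side is a padded
    -- residue vector: write D(y_t) − D(y_last) = r_t + f_t·q and subtract
    -- Δ W for W = a·[x_last] + padLast f, where a = −D(y_last) − Σ f.
    module Normalise (D : Div (k ℕ.+ n)) where

      dₗ : ℤ
      dₗ = D (Y (fromℕ n′))

      δ f : Vec n′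
      δ t = D (Y (inject₁ t)) - dₗ
      f t = δ t / + q

      r : Fin n′ → Fin q
      r t = F.fromℕ< (n%d<d (δ t) (+ q))

      a : ℤ
      a = - dₗ - sumFin f

      W : Div (k ℕ.+ n)
      W = pair (λ x → a * indEq x (fromℕ m)) (padLast f)

      D′ : Div (k ℕ.+ n)
      D′ v = D v - Δ (join Γ n) W v

      D∼D′ : D ∼⟨ join Γ n ⟩ D′
      D∼D′ = W , λ v → cancel (D v) (Δ (join Γ n) W v)
        where
        cancel : ∀ d w → d - (d - w) ≡ w
        cancel = solve-∀

      deg-D′ : deg D ≡ 0ℤ → deg D′ ≡ 0ℤ
      deg-D′ deg≡0 = trans (sumFin-- D (Δ (join Γ n) W)) (cong₂ _-_ deg≡0 (deg-Δ (join Γ n) W))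

      -- The constant terms of Δ W on K_n cancel D(y_last).
      D′-Y : ∀ y → D′ (Y y) ≡ (D (Y y) - dₗ) - + q * padLast f y
      D′-Y y = begin
        D (Y y) - Δ (join Γ n) W (Y y)
          ≡⟨ cong (_-_ (D (Y y))) (Δ-pair-Y _ (padLast f) y) ⟩
        D (Y y) - (+ q * padLast f y - (sumFin (λ x → a * indEq x (fromℕ m)) + deg (padLast f)))
          ≡⟨ cong (λ s → D (Y y) - (+ q * padLast f y - s))
                  (cong₂ _+_ (trans (sumFin-*ˡ a (λ x → indEq x (fromℕ m))) (trans (cong (a *_) (deg-indEq (fromℕ m))) (*-identityʳ a)))
                             (deg-padLast f)) ⟩
        D (Y y) - (+ q * padLast f y - ((- dₗ - sumFin f) + sumFin f))
          ≡⟨ regroup (D (Y y)) dₗ (+ q * padLast f y) (sumFin f) ⟩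
        (D (Y y) - dₗ) - + q * padLast f y ∎
        where
        open ≡-Reasoning
        regroup : ∀ d l p s → d - (p - ((- l - s) + s)) ≡ (d - l) - p
        regroup = solve-∀

      D′-on-Y : ∀ y → D′ (Y y) ≡ padLast (residues r) y
      D′-on-Y y with last-or-inject₁ y
      ... | inj₁ (t , refl) = begin
        D′ (Y (inject₁ t))                               ≡⟨ D′-Y (inject₁ t) ⟩
        δ t - + q * padLast f (inject₁ t)                ≡⟨ cong₂ (λ d p → d - + q * p) (a≡a%n+[a/n]*n (δ t) (+ q)) (padLast-inject₁ f t) ⟩
        (+ (δ t % + q) + f t * + q) - + q * f t          ≡⟨ cancel (+ (δ t % + q)) (f t) (+ q) ⟩
        + (δ t % + q)                                    ≡⟨ cong +_ (toℕ-fromℕ< (n%d<d (δ t) (+ q))) ⟨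
        residues r t                                     ≡⟨ padLast-inject₁ (residues r) t ⟨
        padLast (residues r) (inject₁ t)                 ∎
        where
        open ≡-Reasoning
        cancel : ∀ ρ f q → (ρ + f * q) - q * f ≡ ρ
        cancel = solve-∀
      ... | inj₂ refl = begin
        D′ (Y (fromℕ n′))                                ≡⟨ D′-Y (fromℕ n′) ⟩
        (dₗ - dₗ) - + q * padLast f (fromℕ n′)           ≡⟨ cong₂ (λ d p → d - + q * p) (+-inverseʳ dₗ) (padLast-last f) ⟩
        0ℤ - + q * 0ℤ                                    ≡⟨ cong (_-_ 0ℤ) (*-zeroʳ (+ q)) ⟩
        0ℤ                                               ≡⟨ padLast-last (residues r) ⟨
        padLast (residues r) (fromℕ n′)                  ∎
        where open ≡-Reasoning

    rep-complete : ∀ D → deg D ≡ 0ℤ → ∃₂ λ r i → D ∼⟨ join Γ n ⟩ rep r i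
    rep-complete D deg≡0 =
      let i , D′∼rep = reach-rep r D′ (deg-D′ deg≡0) D′-on-Y
      in  r , i , ∼-trans {Γ = join Γ n} {D} {D′} {rep r i} D∼D′ D′∼rep
      where open Normalise D

    picCard : PicCard (join Γ n) (q ℕ.^ n′ ℕ.* c)
    picCard = PicCard-indexed (join Γ n) rep rep-cong deg-rep rep-distinct rep-complete

-- For k = m + 1, n = n′ + 1 and q = n + k, the matrix
-- N = charMatrix Γ (−n) has trivial kernel, so its cokernel has
-- |det N| = |P_Γ(−n)| elements; the representatives of Pic⁰(Γ_n) built from
-- it number q^{n−1}·|P_Γ(−n)|, and φ embeds (ℤ/q)^{n−1}.
corollaryA : (k n : ℕ) → 1 ℕ.≤ k → 1 ℕ.≤ n → (Γ : Graph k) → Connected Γ →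
    HasSubgroupZmodPow (join Γ n) (n ℕ.+ k) (n ∸ 1)
    × Σ ℕ (λ m → PicCard (join Γ n) m
    × m ≡ (n ℕ.+ k) ^ (n ∸ 1) ℕ.* ∣ charPolyAt Γ (- (+ n)) ∣)
corollaryA (suc m) (suc n′) _ _ Γ _ = subgroup , (_ , picCard , refl)
  where
  open Corollary {m} {n′} Γ
  N-enum : CokerEnum (charMatrix Γ (- + n)) ∣ charPolyAt Γ (- + n) ∣
  N-enum = cokernel-size m (charMatrix Γ (- + n)) (KernelFree-charMatrix Γ n (s≤s z≤n))
  open Representatives N-enum
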